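{- For integers $n\geqslant 1$ and $t,s,r$, let $p(n,t,s,r)=\#\{\pi\in\mathfrak{S}_n:\operatorname{cpk}(\pi)=t,\ \operatorname{cyc}(\pi)=s,\ \operatorname{fix}(\pi)=r\}$ (so $p(n,t,s,r)=0$ whenever no such permutation exists, e.g. if an index is negative). Then for all $n\geqslant 1$ and all $t,s,r$, \begin{align*} p(n+1,t,s,r)&=(2t+s-r)\,p(n,t,s,r)+p(n,t,s-1,r-1)\\ &\quad+(r+1)\,p(n,t,s,r+1)+(n+2-2t-s)\,p(n,t-1,s,r). \end{align*}
   Context: $\mathfrak{S}_n$ is the set of permutations of $[n]=\{1,\dots,n\}$. Every permutation is written in standard cycle decomposition: each cycle is written with its smallest entry first, and cycles are listed in increasing order of their smallest entries. For a cycle $(c_1,c_2,\dots,c_\ell)$ so written, an entry $c_m$ with $2\leqslant m\leqslant \ell-1$ is a cyclic peak if $c_{m-1}<c_m>c_{m+1}$. $\operatorname{cpk}(\pi)$ is the total number of cyclic peaks over all cycles of $\pi$, $\operatorname{cyc}(\pi)$ is the number of cycles of $\pi$, and $\operatorname{fix}(\pi)=\#\{i:\pi(i)=i\}$ is the number of fixed points. -}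

module Defs where

open import Data.Bool using (Bool; true; false; _∧_; if_then_else_; not)
open import Data.Nat using (ℕ; zero; suc; _+_)
open import Data.Fin using (Fin; zero; suc; _<?_; _≤?_; _≟_)
open import Data.Fin.Base using (toℕ)
open import Data.List using (List; []; _∷_; map; concatMap; filter; length; takeWhile)
open import Data.Bool.ListAction using (all; any)
open import Data.Nat.ListAction using (sum)
open import Data.List.Base using (iterate)
open import Data.Vec.Functional using () renaming (_∷_ to _∷ᶠ_)
open import Data.Integer using (ℤ; +_)
import Data.Integer as ℤ
open import Relation.Nullary.Decidable using (⌊_⌋; ¬?)
open import Relation.Unary using (Decidable)
open import Data.Fin.Base using (Fin)
open import Data.List.Base using (allFin)

allFuns : (n m : ℕ) → List (Fin n → Fin m)
allFuns zero    m = (λ ()) ∷ []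
allFuns (suc n) m = concatMap (λ f → map (λ k → k ∷ᶠ f) (allFin m)) (allFuns n m)

isInjective : {n : ℕ} → (Fin n → Fin n) → Bool
isInjective {n} f =
  all (λ i → all (λ j → not ⌊ f i ≟ f j ⌋ Data.Bool.∨ ⌊ i ≟ j ⌋) (allFin n)) (allFin n)
  where import Data.Bool

isSurjective : {n : ℕ} → (Fin n → Fin n) → Bool
isSurjective {n} f = all (λ y → any (λ x → ⌊ f x ≟ y ⌋) (allFin n)) (allFin n)

isPerm : {n : ℕ} → (Fin n → Fin n) → Bool
isPerm f = isInjective f ∧ isSurjective f

perms : (n : ℕ) → List (Fin n → Fin n)
perms n = filter (λ f → Data.Bool._≟_ (isPerm f) true) (allFuns n n)
  where import Data.Bool

orbit : {n : ℕ} → (Fin n → Fin n) → Fin n → List (Fin n)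
orbit {n} π x = x ∷ takeWhile (λ y → ¬? (y ≟ x)) (iterate π (π x) n)

isLeader : {n : ℕ} → (Fin n → Fin n) → Fin n → Bool
isLeader π x = all (λ y → ⌊ x ≤? y ⌋) (orbit π x)

-- Standard cycle decomposition: each cycle starts with its smallest entry,
-- cycles listed in increasing order of smallest entries.
cycles : {n : ℕ} → (Fin n → Fin n) → List (List (Fin n))
cycles {n} π = map (orbit π) (filter (λ x → Data.Bool._≟_ (isLeader π x) true) (allFin n))
  where import Data.Bool

peaksOf : {n : ℕ} → List (Fin n) → ℕ
peaksOf (a ∷ b ∷ c ∷ rest) =
  (if ⌊ a <? b ⌋ ∧ ⌊ c <? b ⌋ then 1 else 0) + peaksOf (b ∷ c ∷ rest)
peaksOf _ = 0

cpk : {n : ℕ} → (Fin n → Fin n) → ℕ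
cpk π = sum (map peaksOf (cycles π))

cyc : {n : ℕ} → (Fin n → Fin n) → ℕ
cyc π = length (cycles π)

fix : {n : ℕ} → (Fin n → Fin n) → ℕ
fix {n} π = length (filter (λ i → π i ≟ i) (allFin n))

p : ℕ → ℤ → ℤ → ℤ → ℕ
p n t s r = length (filter
  (λ π → Data.Bool._≟_ (⌊ (+ cpk π) ℤ.≟ t ⌋ ∧ ⌊ (+ cyc π) ℤ.≟ s ⌋ ∧ ⌊ (+ fix π) ℤ.≟ r ⌋) true)
  (perms n))
  where import Data.Bool

-- Every permutation of [n+1] arises exactly once from a permutation σ of [n] by inserting n+1 either
-- right after some a in its cycle or as a new fixed point. A new fixed point raises cyc and fix by one
-- and keeps cpk. Inserting after a keeps cyc, lowers fix by one when a was fixed, and changes cpk by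
-- the peak gained at n+1 (unless a ends its cycle) minus the peaks lost at a or right after a; this
-- change is 0 or 1, and 0 when a is fixed. Summed over a, it equals n - cyc - 2 cpk: each of the
-- n - cyc non-final entries gains a peak and every peak is lost twice. So of the n insertions after
-- some a, fix lower fix, n - cyc - 2 cpk raise cpk and the remaining 2 cpk + cyc - fix change
-- nothing, which is the recurrence.
module Submission where

open import Defs

import Data.Nat.Properties as ℕ
open import Algebra.Properties.Semiring.Sum ℕ.+-*-semiring
  using (sum-cong-≗; ∑-distrib-+; sum-replicate-zero; sum-init-last) renaming (sum to ∑)
open import Data.Bool using (Bool; true; false; if_then_else_; not; _∧_; _∨_; T)
import Data.Bool as Bool
open import Data.Bool.ListAction using (all; and)
open import Data.Bool.Properties using (∧-assoc; ∧-zeroʳ; ∧-identityʳ; ∨-identityʳ; T-∧; T-≡)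
open import Data.Empty using (⊥-elim)
open import Data.Fin using (Fin; zero; suc; inject₁; fromℕ; toℕ; _≟_; _≤?_; _<?_)
open import Data.Fin.Permutation.Components using (transpose)
open import Data.Fin.Properties using (fromℕ≢inject₁; inject₁-injective; toℕ-inject₁; toℕ-fromℕ; toℕ<n)
open import Data.Fin.Relation.Unary.Top using (View; view; ‵fromℕ; ‵inject₁; view-fromℕ; view-inject₁)
open import Data.Integer using (ℤ; +_)
import Data.Integer as ℤ
import Data.Integer.Properties as ℤ
import Data.Integer.Tactic.RingSolver as ℤ
open import Data.List using (List; []; _∷_; [_]; _++_; map; filter; concat; length; allFin; tabulate; takeWhile; iterate; cartesianProductWith)
open import Data.List.Membership.Propositional using (_∈_)
open import Data.List.Membership.Propositional.Properties
  using (∈-map⁺; ∈-map⁻; ∈-filter⁺; ∈-filter⁻; ∈-allFin; ∈-concatMap⁺; ∈-cartesianProductWith⁺; ∈-cartesianProductWith⁻)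
open import Data.List.Membership.Propositional.Properties.WithK using (unique∧set⇒bag)
open import Data.List.Properties
  using (map-++; map-∘; map-cong; map-id; length-map; length-++; filter-++; map-tabulate; ++-identityʳ; concat-map; concat-++)
open import Data.List.Relation.Binary.BagAndSetEquality using (∼bag⇒↭)
open import Data.List.Relation.Binary.Permutation.Propositional using (_↭_)
open import Data.List.Relation.Binary.Permutation.Propositional.Properties using (↭-length; filter-↭)
import Data.List.Relation.Unary.All as All
open import Data.List.Relation.Unary.All.Properties using (all⁺; all⁻)
import Data.List.Relation.Unary.All.Properties as All
open import Data.List.Relation.Unary.Any using (here; there)
import Data.List.Relation.Unary.Any as Any
open import Data.List.Relation.Unary.Any.Properties using (any⁺; any⁻)
open import Data.List.Relation.Unary.Unique.Propositional using (Unique; []; _∷_)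
import Data.List.Relation.Unary.Unique.Propositional.Properties as Unique
open import Data.Nat using (ℕ; zero; suc; _+_; _*_; _∸_; _≤_; z≤n; s≤s; s≤s⁻¹)
open import Data.Nat.ListAction using (sum)
open import Data.Nat.ListAction.Properties using (sum-++)
open import Data.Nat.Properties
  using ( ≤-refl; ≤-trans; ≤-reflexive; +-comm; +-assoc; +-suc; +-identityʳ; *-identityˡ; *-identityʳ
        ; +-mono-≤; +-monoʳ-≤; m≤m+n; m≤n+m; m∸n+n≡m; m∸n≤m; n≤0⇒n≡0; +-cancelʳ-≡; +-cancelʳ-≤; <⇒≱; n≮n; <-asym; 0∸n≡0)
open import Data.Nat.Tactic.RingSolver using (solve-∀)
open import Data.Product using (∃; _×_; _,_; proj₁; proj₂)
open import Data.Sum using (_⊎_; inj₁; inj₂)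
open import Data.Vec using (Vec)
import Data.Vec as Vec
import Data.Vec.Properties as Vec
open import Data.Vec.Functional using () renaming (_∷_ to _∷ᶠ_)
open import Function using (_∘_; id)
open import Function.Bundles using (Equivalence; mk⇔)
open import Function.Definitions using (Injective; StrictlySurjective)
open import Relation.Binary.PropositionalEquality hiding ([_])
open import Relation.Nullary using (Dec; yes; no; does; ¬?)
open import Relation.Nullary.Decidable using (⌊_⌋; isYes≗does; dec-true; dec-false; toWitness; fromWitness; does-⇔)
open import Relation.Unary using (Decidable)

bit : Bool → ℕ
bit b = if b then 1 else 0

bit≤1 : ∀ b → bit b ≤ 1
bit≤1 true  = s≤s z≤n
bit≤1 false = z≤n

module _ {A : Set} where

  all-++ : ∀ (p : A → Bool) xs ys → all p (xs ++ ys) ≡ all p xs ∧ all p ys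
  all-++ p []       ys = refl
  all-++ p (x ∷ xs) ys = trans (cong (p x ∧_) (all-++ p xs ys)) (sym (∧-assoc (p x) _ _))

  all-map : ∀ {B : Set} (p : A → Bool) (f : B → A) xs → all p (map f xs) ≡ all (p ∘ f) xs
  all-map p f xs = cong and (sym (map-∘ xs))

  all-cong : ∀ {p q : A → Bool} → (∀ x → p x ≡ q x) → ∀ xs → all p xs ≡ all q xs
  all-cong eq xs = cong and (map-cong eq xs)

  module _ {P : A → Set} (P? : Decidable P) where

    filter-map : ∀ {B : Set} {Q : B → Set} (Q? : Decidable Q) (f : B → A) →
                 (∀ x → does (P? (f x)) ≡ does (Q? x)) →
                 ∀ xs → filter P? (map f xs) ≡ map f (filter Q? xs)
    filter-map Q? f eq [] = refl
    filter-map Q? f eq (x ∷ xs) with P? (f x) | Q? x | eq x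
    ... | yes _ | yes _ | _  = cong (f x ∷_) (filter-map Q? f eq xs)
    ... | no _  | no _  | _  = filter-map Q? f eq xs
    ... | yes _ | no _  | ()
    ... | no _  | yes _ | ()

    filter-cong : ∀ {Q : A → Set} (Q? : Decidable Q) →
                  (∀ x → does (P? x) ≡ does (Q? x)) → ∀ xs → filter P? xs ≡ filter Q? xs
    filter-cong Q? eq xs = begin
      filter P? xs            ≡⟨ cong (filter P?) (sym (map-id xs)) ⟩
      filter P? (map id xs)   ≡⟨ filter-map Q? id eq xs ⟩
      map id (filter Q? xs)   ≡⟨ map-id _ ⟩
      filter Q? xs            ∎
      where open ≡-Reasoning

    length-filter≡sum : ∀ xs → length (filter P? xs) ≡ sum (map (bit ∘ does ∘ P?) xs)
    length-filter≡sum []       = refl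
    length-filter≡sum (x ∷ xs) with does (P? x)
    ... | true  = cong suc (length-filter≡sum xs)
    ... | false = length-filter≡sum xs

  sum-map-+ : ∀ (f g : A → ℕ) xs → sum (map (λ x → f x + g x) xs) ≡ sum (map f xs) + sum (map g xs)
  sum-map-+ f g []       = refl
  sum-map-+ f g (x ∷ xs) = trans (cong (λ y → f x + g x + y) (sum-map-+ f g xs)) (shuffle (f x) (g x) _ _)
    where
    shuffle : ∀ a b c d → a + b + (c + d) ≡ a + c + (b + d)
    shuffle = solve-∀

  sum-map-*ˡ : ∀ k (f : A → ℕ) xs → sum (map (λ x → k * f x) xs) ≡ k * sum (map f xs)
  sum-map-*ˡ k f []       = sym (ℕ.*-zeroʳ k)
  sum-map-*ˡ k f (x ∷ xs) = trans (cong (λ y → k * f x + y) (sum-map-*ˡ k f xs)) (sym (ℕ.*-distribˡ-+ k (f x) _))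

  sum-map-cong : ∀ {f g : A → ℕ} → (∀ x → f x ≡ g x) → ∀ xs → sum (map f xs) ≡ sum (map g xs)
  sum-map-cong eq xs = cong sum (map-cong eq xs)

  sum-map-mono : ∀ {f g : A → ℕ} → (∀ x → f x ≤ g x) → ∀ xs → sum (map f xs) ≤ sum (map g xs)
  sum-map-mono le []       = z≤n
  sum-map-mono le (x ∷ xs) = +-mono-≤ (le x) (sum-map-mono le xs)

tabulate-suc : ∀ {A : Set} n (f : Fin (suc n) → A) → tabulate f ≡ tabulate (f ∘ inject₁) ++ [ f (fromℕ n) ]
tabulate-suc zero    f = refl
tabulate-suc (suc n) f = cong (f zero ∷_) (tabulate-suc n (f ∘ suc))

allFin-suc : ∀ n → allFin (suc n) ≡ map inject₁ (allFin n) ++ [ fromℕ n ]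
allFin-suc n = trans (tabulate-suc n id) (cong (_++ [ fromℕ n ]) (sym (map-tabulate id inject₁)))

sum-tabulate : ∀ n (f : Fin n → ℕ) → sum (tabulate f) ≡ ∑ f
sum-tabulate zero    f = refl
sum-tabulate (suc n) f = cong (λ y → f zero + y) (sum-tabulate n (f ∘ suc))

sum-map-allFin : ∀ n (f : Fin n → ℕ) → sum (map f (allFin n)) ≡ ∑ f
sum-map-allFin n f = trans (cong sum (map-tabulate id f)) (sum-tabulate n f)

∑-one : ∀ n → ∑ {n} (λ _ → 1) ≡ n
∑-one zero    = refl
∑-one (suc n) = cong suc (∑-one n)

∑-delta : ∀ {n} (a : Fin n) (f : Fin n → ℕ) → ∑ (λ i → bit (does (a ≟ i)) * f i) ≡ f a
∑-delta {suc n} zero    f = trans (cong₂ _+_ (*-identityˡ (f zero)) (sum-replicate-zero n)) (+-identityʳ (f zero))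
∑-delta {suc n} (suc a) f = ∑-delta a (f ∘ suc)

∑-indicator : ∀ {n} (a : Fin n) → ∑ (λ i → bit (does (a ≟ i))) ≡ 1
∑-indicator {n} a = trans (sum-cong-≗ (λ i → sym (*-identityʳ (bit (does (a ≟ i)))))) (∑-delta a (λ _ → 1))

∑-linear₃ : ∀ {n} (f g h : Fin n → ℕ) x y z → ∑ (λ a → f a * x + g a * y + h a * z) ≡ x * ∑ f + y * ∑ g + z * ∑ h
∑-linear₃ {zero}  f g h x y z = sym (vanish x y z)
  where
  vanish : ∀ x y z → x * 0 + y * 0 + z * 0 ≡ 0
  vanish = solve-∀
∑-linear₃ {suc n} f g h x y z =
  trans (cong (λ k → f zero * x + g zero * y + h zero * z + k) (∑-linear₃ (f ∘ suc) (g ∘ suc) (h ∘ suc) x y z))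
        (distribute (f zero) (g zero) (h zero) (∑ (f ∘ suc)) (∑ (g ∘ suc)) (∑ (h ∘ suc)) x y z)
  where
  distribute : ∀ a b c A B C x y z → a * x + b * y + c * z + (x * A + y * B + z * C) ≡ x * (a + A) + y * (b + B) + z * (c + C)
  distribute = solve-∀

∑-sum-comm : ∀ {n} {A : Set} (f : Fin n → A → ℕ) xs →
             ∑ (λ a → sum (map (f a) xs)) ≡ sum (map (λ x → ∑ (λ a → f a x)) xs)
∑-sum-comm {n} f []       = sum-replicate-zero n
∑-sum-comm {n} f (x ∷ xs) = trans (∑-distrib-+ (λ a → f a x) (λ a → sum (map (f a) xs)))
                                  (cong (λ y → ∑ (λ a → f a x) + y) (∑-sum-comm f xs))

module _ {A : Set} (p : A → Bool) {x : A} where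

  filter-[]-accept : p x ≡ true → filter (λ y → p y Bool.≟ true) [ x ] ≡ [ x ]
  filter-[]-accept px rewrite px = refl

  filter-[]-reject : p x ≡ false → filter (λ y → p y Bool.≟ true) [ x ] ≡ []
  filter-[]-reject px rewrite px = refl

module _ {m : ℕ} where

  transpose-matchˡ : ∀ (i j : Fin m) → transpose i j i ≡ j
  transpose-matchˡ i j rewrite dec-true (i ≟ i) refl = refl

  transpose-matchʳ : ∀ (i j : Fin m) → transpose i j j ≡ i
  transpose-matchʳ i j with j ≟ i
  ... | yes j≡i = j≡i
  ... | no _ rewrite dec-true (j ≟ j) refl = refl

  transpose-other : ∀ {i j k : Fin m} → k ≢ i → k ≢ j → transpose i j k ≡ k
  transpose-other {i} {j} {k} k≢i k≢j rewrite dec-false (k ≟ i) k≢i | dec-false (k ≟ j) k≢j = refl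

  transpose-involutive : ∀ (i j k : Fin m) → transpose i j (transpose i j k) ≡ k
  transpose-involutive i j k = by-cases (k ≟ i) (k ≟ j)
    where
    by-cases : Dec (k ≡ i) → Dec (k ≡ j) → transpose i j (transpose i j k) ≡ k
    by-cases (yes refl) _        = trans (cong (transpose i j) (transpose-matchˡ i j)) (transpose-matchʳ i j)
    by-cases (no _)     (yes refl) = trans (cong (transpose i j) (transpose-matchʳ i j)) (transpose-matchˡ i j)
    by-cases (no k≢i)   (no k≢j) = trans (cong (transpose i j) (transpose-other k≢i k≢j)) (transpose-other k≢i k≢j)

inject₁≢fromℕ : ∀ {n} (i : Fin n) → inject₁ i ≢ fromℕ n
inject₁≢fromℕ i eq = fromℕ≢inject₁ (sym eq)

-- The new element n+1 of [n+1] is fromℕ n.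
extend : ∀ {n} → (Fin n → Fin n) → Fin (suc n) → Fin (suc n)
extend {n} σ x with view x
... | ‵fromℕ     = fromℕ n
... | ‵inject₁ i = inject₁ (σ i)

module _ {n : ℕ} (σ : Fin n → Fin n) where

  extend-inject₁ : ∀ i → extend σ (inject₁ i) ≡ inject₁ (σ i)
  extend-inject₁ i rewrite view-inject₁ i = refl

  extend-fromℕ : extend σ (fromℕ n) ≡ fromℕ n
  extend-fromℕ rewrite view-fromℕ n = refl

  -- insert σ c puts n+1 right after c in its cycle (π c = n+1, π (n+1) = σ c),
  -- or makes n+1 a new fixed point when c = n+1 itself.
  insert : Fin (suc n) → Fin (suc n) → Fin (suc n)
  insert c = extend σ ∘ transpose c (fromℕ n)

  insert-self : ∀ c → insert c c ≡ fromℕ n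
  insert-self c = trans (cong (extend σ) (transpose-matchˡ c (fromℕ n))) extend-fromℕ

  insert-fromℕ : ∀ c → insert c (fromℕ n) ≡ extend σ c
  insert-fromℕ c = cong (extend σ) (transpose-matchʳ c (fromℕ n))

  insert-inject₁ : ∀ c i → inject₁ i ≢ c → insert c (inject₁ i) ≡ inject₁ (σ i)
  insert-inject₁ c i i≢c = trans (cong (extend σ) (transpose-other i≢c (inject₁≢fromℕ i))) (extend-inject₁ i)

fromℕ-or-inject₁ : ∀ {n} (x : Fin (suc n)) → x ≡ fromℕ n ⊎ ∃ λ i → x ≡ inject₁ i
fromℕ-or-inject₁ x with view x
... | ‵fromℕ     = inj₁ refl
... | ‵inject₁ i = inj₂ (i , refl)

module _ {m : ℕ} (i j : Fin m) where

  transpose-injective : Injective _≡_ _≡_ (transpose i j)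
  transpose-injective {x} {y} eq =
    trans (sym (transpose-involutive i j x)) (trans (cong (transpose i j) eq) (transpose-involutive i j y))

  transpose-surjective : StrictlySurjective _≡_ (transpose i j)
  transpose-surjective y = transpose i j y , transpose-involutive i j y

module _ {n : ℕ} {σ : Fin n → Fin n} where

  extend-injective : Injective _≡_ _≡_ σ → Injective _≡_ _≡_ (extend σ)
  extend-injective inj {x} {y} eq with fromℕ-or-inject₁ x | fromℕ-or-inject₁ y
  ... | inj₁ refl      | inj₁ refl      = refl
  ... | inj₁ refl      | inj₂ (j , refl) =
    ⊥-elim (fromℕ≢inject₁ (trans (sym (extend-fromℕ σ)) (trans eq (extend-inject₁ σ j))))
  ... | inj₂ (i , refl) | inj₁ refl      =
    ⊥-elim (inject₁≢fromℕ (σ i) (trans (sym (extend-inject₁ σ i)) (trans eq (extend-fromℕ σ))))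
  ... | inj₂ (i , refl) | inj₂ (j , refl) =
    cong inject₁ (inj (inject₁-injective (trans (sym (extend-inject₁ σ i)) (trans eq (extend-inject₁ σ j)))))

  extend-surjective : StrictlySurjective _≡_ σ → StrictlySurjective _≡_ (extend σ)
  extend-surjective surj y with fromℕ-or-inject₁ y
  ... | inj₁ refl       = fromℕ n , extend-fromℕ σ
  ... | inj₂ (j , refl) = let (i , σi≡j) = surj j in inject₁ i , trans (extend-inject₁ σ i) (cong inject₁ σi≡j)

  insert-injective : Injective _≡_ _≡_ σ → ∀ c → Injective _≡_ _≡_ (insert σ c)
  insert-injective inj c = transpose-injective c (fromℕ n) ∘ extend-injective inj

  insert-surjective : StrictlySurjective _≡_ σ → ∀ c → StrictlySurjective _≡_ (insert σ c)
  insert-surjective surj c y =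
    let (x , ex) = extend-surjective surj y
        (z , ez) = transpose-surjective c (fromℕ n) x
    in z , trans (cong (extend σ) ez) ex

lowerOr : ∀ {n} → Fin n → {x : Fin (suc n)} → View x → Fin n
lowerOr d ‵fromℕ       = d
lowerOr d (‵inject₁ k) = k

-- i is a junk value, only used when ρ sends inject₁ i to n+1.
restrict : ∀ {n} → (Fin (suc n) → Fin (suc n)) → Fin n → Fin n
restrict ρ i = lowerOr i (view (ρ (inject₁ i)))

module _ {n : ℕ} where

  restrict-inject₁ : ∀ (ρ : Fin (suc n) → Fin (suc n)) {i k} → ρ (inject₁ i) ≡ inject₁ k → restrict ρ i ≡ k
  restrict-inject₁ ρ {i} {k} eq rewrite eq | view-inject₁ k = refl

  restrict-cong : ∀ {ρ ρ' : Fin (suc n) → Fin (suc n)} → (∀ x → ρ x ≡ ρ' x) → ∀ i → restrict ρ i ≡ restrict ρ' i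
  restrict-cong eq i = cong (lowerOr i ∘ view) (eq (inject₁ i))

  restrict-extend : ∀ (σ : Fin n → Fin n) i → restrict (extend σ) i ≡ σ i
  restrict-extend σ i = restrict-inject₁ (extend σ) {i} (extend-inject₁ σ i)

  module _ {ρ : Fin (suc n) → Fin (suc n)} (inj : Injective _≡_ _≡_ ρ) (fixed : ρ (fromℕ n) ≡ fromℕ n) where

    extend-restrict : ∀ x → extend (restrict ρ) x ≡ ρ x
    extend-restrict x with fromℕ-or-inject₁ x
    ... | inj₁ refl = trans (extend-fromℕ _) (sym fixed)
    ... | inj₂ (i , refl) with fromℕ-or-inject₁ (ρ (inject₁ i))
    ...   | inj₁ ρi≡top = ⊥-elim (inject₁≢fromℕ i (inj (trans ρi≡top (sym fixed))))
    ...   | inj₂ (k , ρi≡k) = trans (extend-inject₁ _ i) (trans (cong inject₁ (restrict-inject₁ ρ {i} ρi≡k)) (sym ρi≡k))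

    restrict-injective : Injective _≡_ _≡_ (restrict ρ)
    restrict-injective {i} {j} eq = inject₁-injective (inj (begin
      ρ (inject₁ i)                     ≡⟨ sym (extend-restrict (inject₁ i)) ⟩
      extend (restrict ρ) (inject₁ i)   ≡⟨ extend-inject₁ _ i ⟩
      inject₁ (restrict ρ i)            ≡⟨ cong inject₁ eq ⟩
      inject₁ (restrict ρ j)            ≡⟨ sym (extend-inject₁ _ j) ⟩
      extend (restrict ρ) (inject₁ j)   ≡⟨ extend-restrict (inject₁ j) ⟩
      ρ (inject₁ j)                     ∎))
      where open ≡-Reasoning

    restrict-surjective : StrictlySurjective _≡_ ρ → StrictlySurjective _≡_ (restrict ρ)
    restrict-surjective surj y with surj (inject₁ y)
    ... | x , ρx≡y with fromℕ-or-inject₁ x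
    ...   | inj₁ refl      = ⊥-elim (fromℕ≢inject₁ (trans (sym fixed) ρx≡y))
    ...   | inj₂ (i , refl) = i , restrict-inject₁ ρ {i} ρx≡y

-- Removes n+1 from its cycle in π, where it follows c.
delete : ∀ {n} → (Fin (suc n) → Fin (suc n)) → Fin (suc n) → Fin n → Fin n
delete {n} π c = restrict (π ∘ transpose c (fromℕ n))

module _ {n : ℕ} where

  delete-insert : ∀ (σ : Fin n → Fin n) c i → delete (insert σ c) c i ≡ σ i
  delete-insert σ c i = trans (restrict-cong (λ x → cong (extend σ) (transpose-involutive c (fromℕ n) x)) i)
                              (restrict-extend σ i)

  module _ {π : Fin (suc n) → Fin (suc n)} (inj : Injective _≡_ _≡_ π) {c} (πc≡top : π c ≡ fromℕ n) where

    private
      τ : Fin (suc n) → Fin (suc n)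
      τ = transpose c (fromℕ n)

      π∘τ-injective : Injective _≡_ _≡_ (π ∘ τ)
      π∘τ-injective = transpose-injective c (fromℕ n) ∘ inj

      π∘τ-fixed : π (τ (fromℕ n)) ≡ fromℕ n
      π∘τ-fixed = trans (cong π (transpose-matchʳ c (fromℕ n))) πc≡top

    insert-delete : ∀ x → insert (delete π c) c x ≡ π x
    insert-delete x = trans (extend-restrict π∘τ-injective π∘τ-fixed (τ x)) (cong π (transpose-involutive c (fromℕ n) x))

    delete-injective : Injective _≡_ _≡_ (delete π c)
    delete-injective = restrict-injective π∘τ-injective π∘τ-fixed

    delete-surjective : StrictlySurjective _≡_ π → StrictlySurjective _≡_ (delete π c)
    delete-surjective surj = restrict-surjective π∘τ-injective π∘τ-fixed λ y →
      let (x , πx≡y) = surj y in τ x , trans (cong π (transpose-involutive c (fromℕ n) x)) πx≡y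

occurrences : ∀ {m} → Fin m → List (Fin m) → ℕ
occurrences a []      = 0
occurrences a (y ∷ L) = bit (does (y ≟ a)) + occurrences a L

module _ {m : ℕ} (a : Fin m) where

  occurrences-++ : ∀ xs ys → occurrences a (xs ++ ys) ≡ occurrences a xs + occurrences a ys
  occurrences-++ []       ys = refl
  occurrences-++ (x ∷ xs) ys =
    trans (cong (λ y → bit (does (x ≟ a)) + y) (occurrences-++ xs ys)) (sym (+-assoc (bit (does (x ≟ a))) _ _))

  occurrences-concat : ∀ Ls → occurrences a (concat Ls) ≡ sum (map (occurrences a) Ls)
  occurrences-concat []       = refl
  occurrences-concat (L ∷ Ls) = trans (occurrences-++ L (concat Ls)) (cong (λ y → occurrences a L + y) (occurrences-concat Ls))

∑-occurrences : ∀ {m} (L : List (Fin m)) → ∑ (λ a → occurrences a L) ≡ length L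
∑-occurrences {m} []      = sum-replicate-zero m
∑-occurrences     (y ∷ L) = trans (∑-distrib-+ (λ a → bit (does (y ≟ a))) (λ a → occurrences a L)) (cong₂ _+_ (∑-indicator y) (∑-occurrences L))

module _ {m : ℕ} where

  walk : (Fin m → Fin m) → Fin m → Fin m → ℕ → List (Fin m)
  walk π x y k = takeWhile (λ z → ¬? (z ≟ x)) (iterate π y k)

  module _ (π : Fin m → Fin m) (x : Fin m) where

    walk-here : ∀ {y} k → y ≡ x → walk π x y k ≡ []
    walk-here zero    _   = refl
    walk-here {y} (suc k) y≡x rewrite dec-true (y ≟ x) y≡x = refl

    walk-step : ∀ {y} k → y ≢ x → walk π x y (suc k) ≡ y ∷ walk π x (π y) k
    walk-step {y} k y≢x rewrite dec-false (y ≟ x) y≢x = refl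

    data Reaches : Fin m → ℕ → Set where
      here  : ∀ {k} → Reaches x k
      there : ∀ {y k} → Reaches (π y) k → Reaches y (suc k)

    Reaches-mono : ∀ {y k K} → Reaches y k → k ≤ K → Reaches y K
    Reaches-mono here      _         = here
    Reaches-mono (there r) (s≤s k≤K) = there (Reaches-mono r k≤K)

    walk-stable : ∀ {y k} → Reaches y k → ∀ K → k ≤ K → walk π x y K ≡ walk π x y k
    walk-stable {k = k} here K _ = trans (walk-here K refl) (sym (walk-here k refl))
    walk-stable {y} (there {k = k} r) (suc K) (s≤s k≤K) = by-cases (y ≟ x)
      where
      by-cases : Dec (y ≡ x) → walk π x y (suc K) ≡ walk π x y (suc k)
      by-cases (yes y≡x) = trans (walk-here (suc K) y≡x) (sym (walk-here (suc k) y≡x))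
      by-cases (no  y≢x) = trans (walk-step K y≢x)
                                 (trans (cong (y ∷_) (walk-stable r K k≤K)) (sym (walk-step k y≢x)))

  module _ {π π' : Fin m → Fin m} (π≗π' : ∀ x → π x ≡ π' x) where

    iterate-cong : ∀ y k → iterate π y k ≡ iterate π' y k
    iterate-cong y zero    = refl
    iterate-cong y (suc k) = cong (y ∷_) (trans (iterate-cong (π y) k) (cong (λ z → iterate π' z k) (π≗π' y)))

    orbit-cong : ∀ x → orbit π x ≡ orbit π' x
    orbit-cong x = cong (λ L → x ∷ takeWhile (λ y → ¬? (y ≟ x)) L)
                        (trans (iterate-cong (π x) m) (cong (λ y → iterate π' y m) (π≗π' x)))

    isLeader-cong : ∀ x → isLeader π x ≡ isLeader π' x
    isLeader-cong x = cong (all (λ y → ⌊ x ≤? y ⌋)) (orbit-cong x)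

    cycles-cong : cycles π ≡ cycles π'
    cycles-cong = trans
      (cong (map (orbit π)) (filter-cong (λ x → isLeader π x Bool.≟ true) (λ x → isLeader π' x Bool.≟ true)
                              (λ x → cong (λ b → does (b Bool.≟ true)) (isLeader-cong x)) (allFin m)))
      (map-cong orbit-cong _)

    fix-cong : fix π ≡ fix π'
    fix-cong = cong length (filter-cong (λ i → π i ≟ i) (λ i → π' i ≟ i)
                              (λ i → cong (λ z → does (z ≟ i)) (π≗π' i)) (allFin m))

    Reaches-cong : ∀ {x y k} → Reaches π x y k → Reaches π' x y k
    Reaches-cong here = here
    Reaches-cong {x} (there {y} {k} r) = there (subst (λ z → Reaches π' x z k) (π≗π' y) (Reaches-cong r))

insertTopAfter : ∀ {n} → Fin (suc n) → List (Fin (suc n)) → List (Fin (suc n))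
insertTopAfter     c []      = []
insertTopAfter {n} c (x ∷ L) = x ∷ (if does (x ≟ c) then fromℕ n ∷ insertTopAfter c L else insertTopAfter c L)

module _ {n : ℕ} (c : Fin (suc n)) where

  insertTopAfter-match : ∀ {x} L → x ≡ c → insertTopAfter c (x ∷ L) ≡ x ∷ fromℕ n ∷ insertTopAfter c L
  insertTopAfter-match {x} L x≡c rewrite dec-true (x ≟ c) x≡c = refl

  insertTopAfter-skip : ∀ {x} L → x ≢ c → insertTopAfter c (x ∷ L) ≡ x ∷ insertTopAfter c L
  insertTopAfter-skip {x} L x≢c rewrite dec-false (x ≟ c) x≢c = refl

  insertTopAfter-++ : ∀ xs ys → insertTopAfter c (xs ++ ys) ≡ insertTopAfter c xs ++ insertTopAfter c ys
  insertTopAfter-++ []       ys = refl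
  insertTopAfter-++ (x ∷ xs) ys with does (x ≟ c)
  ... | true  = cong (λ zs → x ∷ fromℕ n ∷ zs) (insertTopAfter-++ xs ys)
  ... | false = cong (x ∷_) (insertTopAfter-++ xs ys)

  occurrences-insertTopAfter-inject₁ : ∀ b L → occurrences (inject₁ b) (insertTopAfter c L) ≡ occurrences (inject₁ b) L
  occurrences-insertTopAfter-inject₁ b []      = refl
  occurrences-insertTopAfter-inject₁ b (x ∷ L) with does (x ≟ c)
  ... | true  rewrite dec-false (fromℕ n ≟ inject₁ b) fromℕ≢inject₁ =
    cong (λ y → bit (does (x ≟ inject₁ b)) + y) (occurrences-insertTopAfter-inject₁ b L)
  ... | false = cong (λ y → bit (does (x ≟ inject₁ b)) + y) (occurrences-insertTopAfter-inject₁ b L)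

  occurrences-insertTopAfter-fromℕ : ∀ L → occurrences (fromℕ n) (insertTopAfter c L) ≡ occurrences (fromℕ n) L + occurrences c L
  occurrences-insertTopAfter-fromℕ []      = refl
  occurrences-insertTopAfter-fromℕ (x ∷ L) with x ≟ c
  ... | yes _ rewrite dec-true (fromℕ n ≟ fromℕ n) refl
                    | occurrences-insertTopAfter-fromℕ L = shuffle (bit (does (x ≟ fromℕ n))) _ _
    where
    shuffle : ∀ a b d → a + suc (b + d) ≡ a + b + suc d
    shuffle = solve-∀
  ... | no _ rewrite occurrences-insertTopAfter-fromℕ L = sym (+-assoc (bit (does (x ≟ fromℕ n))) _ _)

module _ {n : ℕ} where

  does-inject₁ : ∀ (x y : Fin n) → does (inject₁ x ≟ inject₁ y) ≡ does (x ≟ y)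
  does-inject₁ x y with x ≟ y
  ... | yes x≡y = dec-true (inject₁ x ≟ inject₁ y) (cong inject₁ x≡y)
  ... | no  x≢y = dec-false (inject₁ x ≟ inject₁ y) (x≢y ∘ inject₁-injective)

  occurrences-map-inject₁ : ∀ (b : Fin n) L → occurrences (inject₁ b) (map inject₁ L) ≡ occurrences b L
  occurrences-map-inject₁ b []      = refl
  occurrences-map-inject₁ b (y ∷ L) = cong₂ _+_ (cong bit (does-inject₁ y b)) (occurrences-map-inject₁ b L)

  occurrences-fromℕ-map-inject₁ : ∀ (L : List (Fin n)) → occurrences (fromℕ n) (map inject₁ L) ≡ 0
  occurrences-fromℕ-map-inject₁ []      = refl
  occurrences-fromℕ-map-inject₁ (y ∷ L) rewrite dec-false (inject₁ y ≟ fromℕ n) (inject₁≢fromℕ y) =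
    occurrences-fromℕ-map-inject₁ L

  insertTopAfter-fromℕ-map-inject₁ : ∀ (L : List (Fin n)) → insertTopAfter (fromℕ n) (map inject₁ L) ≡ map inject₁ L
  insertTopAfter-fromℕ-map-inject₁ []      = refl
  insertTopAfter-fromℕ-map-inject₁ (y ∷ L) =
    trans (insertTopAfter-skip (fromℕ n) (map inject₁ L) (inject₁≢fromℕ y)) (cong (inject₁ y ∷_) (insertTopAfter-fromℕ-map-inject₁ L))

record Orbital {n : ℕ} (σ : Fin n → Fin n) : Set where
  field
    orbit-closes     : ∀ x → Reaches σ x (σ x) n
    orbit-simple     : ∀ x a → occurrences a (orbit σ x) ≤ 1
    cycles-partition : ∀ a → occurrences a (concat (cycles σ)) ≡ 1

module _ {n : ℕ} (σ : Fin n → Fin n) (c : Fin (suc n)) where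

  private
    π : Fin (suc n) → Fin (suc n)
    π = insert σ c
    ι : Fin n → Fin (suc n)
    ι = inject₁
    extra : List (Fin n) → ℕ
    extra w = occurrences c (map ι w)

  insert-at : ∀ {y} → ι y ≡ c → π (ι y) ≡ fromℕ n
  insert-at ιy≡c = trans (cong π ιy≡c) (insert-self σ c)

  insert-fromℕ-at : ∀ {y} → ι y ≡ c → π (fromℕ n) ≡ ι (σ y)
  insert-fromℕ-at {y} ιy≡c = trans (insert-fromℕ σ c) (trans (cong (extend σ) (sym ιy≡c)) (extend-inject₁ σ y))

  extra-match : ∀ {y} w → ι y ≡ c → extra (y ∷ w) ≡ suc (extra w)
  extra-match {y} w ιy≡c = cong (_+ extra w) (cong bit (dec-true (ι y ≟ c) ιy≡c))

  extra-skip : ∀ {y} w → ι y ≢ c → extra (y ∷ w) ≡ extra w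
  extra-skip {y} w ιy≢c = cong (_+ extra w) (cong bit (dec-false (ι y ≟ c) ιy≢c))

  -- Each visit of c costs one extra step, spent at the inserted n+1.
  walk-insert : ∀ {x y k} → Reaches σ x y k →
                walk π (ι x) (ι y) (k + extra (walk σ x y k)) ≡ insertTopAfter c (map ι (walk σ x y k))
  walk-insert {x} {k = k} here rewrite walk-here σ x k refl = walk-here π (ι x) (k + 0) refl
  walk-insert {x} {y} (there {k = k} r) = by-cases (y ≟ x)
    where
    by-cases : Dec (y ≡ x) → walk π (ι x) (ι y) (suc k + extra (walk σ x y (suc k))) ≡
                             insertTopAfter c (map ι (walk σ x y (suc k)))
    by-cases (yes y≡x) rewrite walk-here σ x (suc k) y≡x = walk-here π (ι x) (suc k + 0) (cong ι y≡x)
    by-cases (no  y≢x) rewrite walk-step σ x k y≢x = at-c (ι y ≟ c)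
      where
      w : List (Fin n)
      w = walk σ x (σ y) k
      ιy≢ιx : ι y ≢ ι x
      ιy≢ιx = y≢x ∘ inject₁-injective
      at-c : Dec (ι y ≡ c) → walk π (ι x) (ι y) (suc k + extra (y ∷ w)) ≡ insertTopAfter c (map ι (y ∷ w))
      at-c (yes ιy≡c) = begin
        walk π (ι x) (ι y) (suc k + extra (y ∷ w))           ≡⟨ cong (λ e → walk π (ι x) (ι y) (suc k + e)) (extra-match w ιy≡c) ⟩
        walk π (ι x) (ι y) (suc k + suc (extra w))           ≡⟨ cong (walk π (ι x) (ι y)) (+-suc (suc k) (extra w)) ⟩
        walk π (ι x) (ι y) (suc (suc (k + extra w)))         ≡⟨ walk-step π (ι x) (suc (k + extra w)) ιy≢ιx ⟩
        ι y ∷ walk π (ι x) (π (ι y)) (suc (k + extra w))     ≡⟨ cong (λ z → ι y ∷ walk π (ι x) z (suc (k + extra w))) (insert-at ιy≡c) ⟩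
        ι y ∷ walk π (ι x) (fromℕ n) (suc (k + extra w))     ≡⟨ cong (ι y ∷_) (walk-step π (ι x) (k + extra w) (fromℕ≢inject₁ {i = x})) ⟩
        ι y ∷ fromℕ n ∷ walk π (ι x) (π (fromℕ n)) (k + extra w)
                                                             ≡⟨ cong (λ z → ι y ∷ fromℕ n ∷ walk π (ι x) z (k + extra w)) (insert-fromℕ-at ιy≡c) ⟩
        ι y ∷ fromℕ n ∷ walk π (ι x) (ι (σ y)) (k + extra w) ≡⟨ cong (λ ws → ι y ∷ fromℕ n ∷ ws) (walk-insert r) ⟩
        ι y ∷ fromℕ n ∷ insertTopAfter c (map ι w)           ≡⟨ sym (insertTopAfter-match c (map ι w) ιy≡c) ⟩
        insertTopAfter c (ι y ∷ map ι w)                     ∎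
        where open ≡-Reasoning
      at-c (no ιy≢c) = begin
        walk π (ι x) (ι y) (suc k + extra (y ∷ w))           ≡⟨ cong (λ e → walk π (ι x) (ι y) (suc k + e)) (extra-skip w ιy≢c) ⟩
        walk π (ι x) (ι y) (suc (k + extra w))               ≡⟨ walk-step π (ι x) (k + extra w) ιy≢ιx ⟩
        ι y ∷ walk π (ι x) (π (ι y)) (k + extra w)           ≡⟨ cong (λ z → ι y ∷ walk π (ι x) z (k + extra w)) (insert-inject₁ σ c y ιy≢c) ⟩
        ι y ∷ walk π (ι x) (ι (σ y)) (k + extra w)           ≡⟨ cong (ι y ∷_) (walk-insert r) ⟩
        ι y ∷ insertTopAfter c (map ι w)                     ≡⟨ sym (insertTopAfter-skip c (map ι w) ιy≢c) ⟩
        insertTopAfter c (ι y ∷ map ι w)                     ∎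
        where open ≡-Reasoning

  Reaches-insert : ∀ {x y k} → Reaches σ x y k → Reaches π (ι x) (ι y) (k + extra (walk σ x y k))
  Reaches-insert here = here
  Reaches-insert {x} {y} (there {k = k} r) = by-cases (y ≟ x)
    where
    by-cases : Dec (y ≡ x) → Reaches π (ι x) (ι y) (suc k + extra (walk σ x y (suc k)))
    by-cases (yes refl) = here
    by-cases (no  y≢x) rewrite walk-step σ x k y≢x = at-c (ι y ≟ c)
      where
      w : List (Fin n)
      w = walk σ x (σ y) k
      at-c : Dec (ι y ≡ c) → Reaches π (ι x) (ι y) (suc k + extra (y ∷ w))
      at-c (yes ιy≡c) = subst (Reaches π (ι x) (ι y)) (cong (λ e → suc k + e) (sym (extra-match w ιy≡c)))
        (subst (Reaches π (ι x) (ι y)) (sym (+-suc (suc k) (extra w))) (there (subst (λ z → Reaches π (ι x) z (suc (k + extra w))) (sym (insert-at ιy≡c))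
          (there (subst (λ z → Reaches π (ι x) z (k + extra w)) (sym (insert-fromℕ-at ιy≡c)) (Reaches-insert r))))))
      at-c (no ιy≢c) = subst (Reaches π (ι x) (ι y)) (cong (λ e → suc k + e) (sym (extra-skip w ιy≢c)))
        (there (subst (λ z → Reaches π (ι x) z (k + extra w)) (sym (insert-inject₁ σ c y ιy≢c)) (Reaches-insert r)))

  module _ (O : Orbital σ) where
    open Orbital O

    extra-orbit≤1 : ∀ x → extra (walk σ x (σ x) n) ≤ 1
    extra-orbit≤1 x with fromℕ-or-inject₁ c
    ... | inj₁ c≡top = ≤-trans (≤-reflexive (trans (cong (λ d → occurrences d (map ι w)) c≡top)
                                                   (occurrences-fromℕ-map-inject₁ w))) z≤n
      where
        w : List (Fin n)
        w = walk σ x (σ x) n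
    ... | inj₂ (a , c≡ιa) = ≤-trans (≤-reflexive (trans (cong (λ d → occurrences d (map ι w)) c≡ιa)
                                                        (occurrences-map-inject₁ a w)))
                                    (≤-trans (m≤n+m _ (bit (does (x ≟ a)))) (orbit-simple x a))
      where
        w : List (Fin n)
        w = walk σ x (σ x) n

    extra-orbit-self : ∀ x → ι x ≡ c → extra (walk σ x (σ x) n) ≡ 0
    extra-orbit-self x ιx≡c = begin
      occurrences c (map ι w)        ≡⟨ cong (λ d → occurrences d (map ι w)) (sym ιx≡c) ⟩
      occurrences (ι x) (map ι w)    ≡⟨ occurrences-map-inject₁ x w ⟩
      occurrences x w                ≡⟨ n≤0⇒n≡0 (s≤s⁻¹ x-once) ⟩
      0                              ∎
      where
      open ≡-Reasoning
      w : List (Fin n)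
      w = walk σ x (σ x) n
      x-once : suc (occurrences x w) ≤ 1
      x-once = subst (_≤ 1) (cong (_+ occurrences x w) (cong bit (dec-true (x ≟ x) refl))) (orbit-simple x x)

    private
      fuel-self : ∀ x → ι x ≡ c → n + extra (walk σ x (σ x) n) ≤ n
      fuel-self x ιx≡c = ≤-reflexive (trans (cong (λ y → n + y) (extra-orbit-self x ιx≡c)) (+-identityʳ n))

      fuel-other : ∀ x → n + extra (walk σ x (σ x) n) ≤ suc n
      fuel-other x = subst (n + extra (walk σ x (σ x) n) ≤_) (+-comm n 1) (+-monoʳ-≤ n (extra-orbit≤1 x))

    orbit-inject₁-insert : ∀ x → orbit π (ι x) ≡ insertTopAfter c (map ι (orbit σ x))
    orbit-inject₁-insert x = by-cases (ι x ≟ c)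
      where
      w : List (Fin n)
      w = walk σ x (σ x) n
      walk-fuel : ∀ K → n + extra w ≤ K → walk π (ι x) (ι (σ x)) K ≡ insertTopAfter c (map ι w)
      walk-fuel K le = trans (walk-stable π (ι x) (Reaches-insert (orbit-closes x)) K le) (walk-insert (orbit-closes x))
      by-cases : Dec (ι x ≡ c) → orbit π (ι x) ≡ insertTopAfter c (ι x ∷ map ι w)
      by-cases (yes ιx≡c) = begin
        ι x ∷ walk π (ι x) (π (ι x)) (suc n)                  ≡⟨ cong (λ z → ι x ∷ walk π (ι x) z (suc n)) (insert-at ιx≡c) ⟩
        ι x ∷ walk π (ι x) (fromℕ n) (suc n)                  ≡⟨ cong (ι x ∷_) (walk-step π (ι x) n fromℕ≢inject₁) ⟩
        ι x ∷ fromℕ n ∷ walk π (ι x) (π (fromℕ n)) n           ≡⟨ cong (λ z → ι x ∷ fromℕ n ∷ walk π (ι x) z n) (insert-fromℕ-at ιx≡c) ⟩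
        ι x ∷ fromℕ n ∷ walk π (ι x) (ι (σ x)) n               ≡⟨ cong (λ ws → ι x ∷ fromℕ n ∷ ws) (walk-fuel n (fuel-self x ιx≡c)) ⟩
        ι x ∷ fromℕ n ∷ insertTopAfter c (map ι w)            ≡⟨ sym (insertTopAfter-match c (map ι w) ιx≡c) ⟩
        insertTopAfter c (ι x ∷ map ι w)                      ∎
        where open ≡-Reasoning
      by-cases (no ιx≢c) = begin
        ι x ∷ walk π (ι x) (π (ι x)) (suc n)                  ≡⟨ cong (λ z → ι x ∷ walk π (ι x) z (suc n)) (insert-inject₁ σ c x ιx≢c) ⟩
        ι x ∷ walk π (ι x) (ι (σ x)) (suc n)                  ≡⟨ cong (ι x ∷_) (walk-fuel (suc n) (fuel-other x)) ⟩
        ι x ∷ insertTopAfter c (map ι w)                      ≡⟨ sym (insertTopAfter-skip c (map ι w) ιx≢c) ⟩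
        insertTopAfter c (ι x ∷ map ι w)                      ∎
        where open ≡-Reasoning

    Reaches-inject₁-insert : ∀ x → Reaches π (ι x) (π (ι x)) (suc n)
    Reaches-inject₁-insert x = by-cases (ι x ≟ c)
      where
      by-cases : Dec (ι x ≡ c) → Reaches π (ι x) (π (ι x)) (suc n)
      by-cases (yes ιx≡c) = subst (λ z → Reaches π (ι x) z (suc n)) (sym (insert-at ιx≡c))
        (there (subst (λ z → Reaches π (ι x) z n) (sym (insert-fromℕ-at ιx≡c))
          (Reaches-mono π (ι x) (Reaches-insert (orbit-closes x)) (fuel-self x ιx≡c))))
      by-cases (no ιx≢c) = subst (λ z → Reaches π (ι x) z (suc n)) (sym (insert-inject₁ σ c x ιx≢c))
        (Reaches-mono π (ι x) (Reaches-insert (orbit-closes x)) (fuel-other x))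

module _ {n : ℕ} (σ : Fin n → Fin n) (a : Fin n) where

  private
    π : Fin (suc n) → Fin (suc n)
    π = insert σ (inject₁ a)
    ι : Fin n → Fin (suc n)
    ι = inject₁

  walk-to-fromℕ : ∀ {y k} → Reaches σ a y k → walk π (fromℕ n) (ι y) (suc k) ≡ map ι (walk σ a y k) ++ [ ι a ]
  walk-to-fromℕ {y} {k} here rewrite walk-here σ a k refl =
    trans (walk-step π (fromℕ n) k (inject₁≢fromℕ a))
          (cong (ι a ∷_) (walk-here π (fromℕ n) k (insert-self σ (ι a))))
  walk-to-fromℕ {y} (there {k = k} r) = by-cases (y ≟ a)
    where
    by-cases : Dec (y ≡ a) → walk π (fromℕ n) (ι y) (suc (suc k)) ≡ map ι (walk σ a y (suc k)) ++ [ ι a ]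
    by-cases (yes refl) = walk-to-fromℕ (here {k = suc k})
    by-cases (no y≢a) rewrite walk-step σ a k y≢a =
      trans (walk-step π (fromℕ n) (suc k) (inject₁≢fromℕ y))
            (cong (ι y ∷_) (trans (cong (λ z → walk π (fromℕ n) z (suc k)) (insert-inject₁ σ (ι a) y (y≢a ∘ inject₁-injective)))
                                  (walk-to-fromℕ r)))

  Reaches-to-fromℕ : ∀ {y k} → Reaches σ a y k → Reaches π (fromℕ n) (ι y) (suc k)
  Reaches-to-fromℕ {y} {k} here = there (subst (λ z → Reaches π (fromℕ n) z k) (sym (insert-self σ (ι a))) here)
  Reaches-to-fromℕ {y} (there {k = k} r) = by-cases (y ≟ a)
    where
    by-cases : Dec (y ≡ a) → Reaches π (fromℕ n) (ι y) (suc (suc k))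
    by-cases (yes refl) = Reaches-to-fromℕ (here {k = suc k})
    by-cases (no y≢a)   = there (subst (λ z → Reaches π (fromℕ n) z (suc k))
                                       (sym (insert-inject₁ σ (ι a) y (y≢a ∘ inject₁-injective))) (Reaches-to-fromℕ r))

  module _ (O : Orbital σ) where
    open Orbital O

    orbit-fromℕ-insert-inject₁ : orbit π (fromℕ n) ≡ fromℕ n ∷ map ι (walk σ a (σ a) n) ++ [ ι a ]
    orbit-fromℕ-insert-inject₁ = cong (fromℕ n ∷_)
      (trans (cong (λ z → walk π (fromℕ n) z (suc n)) (insert-fromℕ-at σ (ι a) refl)) (walk-to-fromℕ (orbit-closes a)))

    Reaches-fromℕ-insert-inject₁ : Reaches π (fromℕ n) (π (fromℕ n)) (suc n)
    Reaches-fromℕ-insert-inject₁ =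
      subst (λ z → Reaches π (fromℕ n) z (suc n)) (sym (insert-fromℕ-at σ (ι a) refl)) (Reaches-to-fromℕ (orbit-closes a))

module _ {n : ℕ} (σ : Fin n → Fin n) where

  orbit-fromℕ-insert-fromℕ : orbit (insert σ (fromℕ n)) (fromℕ n) ≡ [ fromℕ n ]
  orbit-fromℕ-insert-fromℕ = cong (fromℕ n ∷_) (walk-here (insert σ (fromℕ n)) (fromℕ n) (suc n) (insert-self σ (fromℕ n)))

fix≡∑ : ∀ {m} (π : Fin m → Fin m) → fix π ≡ ∑ (λ i → bit (does (π i ≟ i)))
fix≡∑ {m} π = trans (length-filter≡sum (λ i → π i ≟ i) (allFin m)) (sum-map-allFin m _)

leaders : ∀ {m} → (Fin m → Fin m) → List (Fin m)
leaders {m} π = filter (λ x → isLeader π x Bool.≟ true) (allFin m)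

module _ {n : ℕ} where

  ≤ᵇ-inject₁ : ∀ (x y : Fin n) → ⌊ inject₁ x ≤? inject₁ y ⌋ ≡ ⌊ x ≤? y ⌋
  ≤ᵇ-inject₁ x y rewrite toℕ-inject₁ x | toℕ-inject₁ y = refl

  ≤ᵇ-fromℕ : ∀ (x : Fin (suc n)) → ⌊ x ≤? fromℕ n ⌋ ≡ true
  ≤ᵇ-fromℕ x = trans (isYes≗does (x ≤? fromℕ n)) (dec-true (x ≤? fromℕ n) (subst (toℕ x ≤_) (sym (toℕ-fromℕ n)) (ℕ.≤-pred (toℕ<n x))))

  fromℕ≰ᵇinject₁ : ∀ (x : Fin n) → ⌊ fromℕ n ≤? inject₁ x ⌋ ≡ false
  fromℕ≰ᵇinject₁ x = trans (isYes≗does (fromℕ n ≤? inject₁ x))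
    (dec-false (fromℕ n ≤? inject₁ x) λ le → <⇒≱ (toℕ<n x) (subst₂ _≤_ (toℕ-fromℕ n) (toℕ-inject₁ x) le))

  all-insertTopAfter : ∀ (p : Fin (suc n) → Bool) → p (fromℕ n) ≡ true → ∀ c L → all p (insertTopAfter c L) ≡ all p L
  all-insertTopAfter p p-top c []      = refl
  all-insertTopAfter p p-top c (x ∷ L) with does (x ≟ c)
  ... | true  rewrite p-top = cong (p x ∧_) (all-insertTopAfter p p-top c L)
  ... | false = cong (p x ∧_) (all-insertTopAfter p p-top c L)

  cycles-suc : ∀ (π : Fin (suc n) → Fin (suc n)) (σ : Fin n → Fin n) → (∀ x → isLeader π (inject₁ x) ≡ isLeader σ x) →
               cycles π ≡ map (orbit π ∘ inject₁) (leaders σ) ++ map (orbit π) (filter (λ x → isLeader π x Bool.≟ true) [ fromℕ n ])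
  cycles-suc π σ same = begin
    map (orbit π) (filter isLeader? (allFin (suc n)))
      ≡⟨ cong (map (orbit π) ∘ filter isLeader?) (allFin-suc n) ⟩
    map (orbit π) (filter isLeader? (map inject₁ (allFin n) ++ [ fromℕ n ]))
      ≡⟨ cong (map (orbit π)) (filter-++ isLeader? (map inject₁ (allFin n)) [ fromℕ n ]) ⟩
    map (orbit π) (filter isLeader? (map inject₁ (allFin n)) ++ filter isLeader? [ fromℕ n ])
      ≡⟨ map-++ (orbit π) (filter isLeader? (map inject₁ (allFin n))) (filter isLeader? [ fromℕ n ]) ⟩
    map (orbit π) (filter isLeader? (map inject₁ (allFin n))) ++ map (orbit π) (filter isLeader? [ fromℕ n ])
      ≡⟨ cong (λ xs → map (orbit π) xs ++ _) (filter-map isLeader? (λ x → isLeader σ x Bool.≟ true) inject₁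
                                                 (λ x → cong (λ b → does (b Bool.≟ true)) (same x)) (allFin n)) ⟩
    map (orbit π) (map inject₁ (leaders σ)) ++ map (orbit π) (filter isLeader? [ fromℕ n ])
      ≡⟨ cong (_++ _) (sym (map-∘ (leaders σ))) ⟩
    map (orbit π ∘ inject₁) (leaders σ) ++ map (orbit π) (filter isLeader? [ fromℕ n ]) ∎
    where
    open ≡-Reasoning
    isLeader? : ∀ x → Dec (isLeader π x ≡ true)
    isLeader? = λ x → isLeader π x Bool.≟ true

  fix-suc : ∀ (π : Fin (suc n) → Fin (suc n)) →
            fix π ≡ ∑ (λ i → bit (does (π (inject₁ i) ≟ inject₁ i))) + bit (does (π (fromℕ n) ≟ fromℕ n))
  fix-suc π = trans (fix≡∑ π) (sum-init-last (λ i → bit (does (π i ≟ i))))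

module _ {n : ℕ} (σ : Fin n → Fin n) where

  private
    ι : Fin n → Fin (suc n)
    ι = inject₁

  fix-insert-inject₁ : ∀ a → fix (insert σ (ι a)) + bit (does (σ a ≟ a)) ≡ fix σ
  fix-insert-inject₁ a = begin
    fix π + bit (does (σ a ≟ a))
      ≡⟨ cong (_+ bit (does (σ a ≟ a))) (fix-suc π) ⟩
    ∑ fixedπ + bit (does (π (fromℕ n) ≟ fromℕ n)) + bit (does (σ a ≟ a))
      ≡⟨ cong (λ b → ∑ fixedπ + bit b + bit (does (σ a ≟ a))) (dec-false (π (fromℕ n) ≟ fromℕ n) top-moves) ⟩
    ∑ fixedπ + 0 + bit (does (σ a ≟ a))
      ≡⟨ cong₂ _+_ (+-identityʳ (∑ fixedπ)) (sym (∑-delta a fixedσ)) ⟩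
    ∑ fixedπ + ∑ (λ i → bit (does (a ≟ i)) * fixedσ i)
      ≡⟨ sym (∑-distrib-+ fixedπ (λ i → bit (does (a ≟ i)) * fixedσ i)) ⟩
    ∑ (λ i → fixedπ i + bit (does (a ≟ i)) * fixedσ i)
      ≡⟨ sum-cong-≗ pointwise ⟩
    ∑ fixedσ
      ≡⟨ sym (fix≡∑ σ) ⟩
    fix σ ∎
    where
    open ≡-Reasoning
    π : Fin (suc n) → Fin (suc n)
    π = insert σ (ι a)
    fixedπ : Fin n → ℕ
    fixedπ = λ i → bit (does (π (ι i) ≟ ι i))
    fixedσ : Fin n → ℕ
    fixedσ = λ i → bit (does (σ i ≟ i))
    top-moves : π (fromℕ n) ≢ fromℕ n
    top-moves eq = inject₁≢fromℕ (σ a) (trans (sym (insert-fromℕ-at σ (ι a) refl)) eq)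
    pointwise : ∀ i → fixedπ i + bit (does (a ≟ i)) * fixedσ i ≡ fixedσ i
    pointwise i with a ≟ i
    ... | yes refl rewrite insert-self σ (ι a) | dec-false (fromℕ n ≟ ι a) fromℕ≢inject₁ = +-identityʳ (fixedσ a)
    ... | no a≢i rewrite insert-inject₁ σ (ι a) i (a≢i ∘ sym ∘ inject₁-injective) | does-inject₁ (σ i) i =
      +-identityʳ (fixedσ i)

  fix-insert-fromℕ : fix (insert σ (fromℕ n)) ≡ suc (fix σ)
  fix-insert-fromℕ = begin
    fix π                                                          ≡⟨ fix-suc π ⟩
    ∑ (λ i → bit (does (π (ι i) ≟ ι i))) + bit (does (π (fromℕ n) ≟ fromℕ n))
      ≡⟨ cong₂ _+_ (sum-cong-≗ λ i → cong bit (trans (cong (λ z → does (z ≟ ι i)) (insert-inject₁ σ (fromℕ n) i (inject₁≢fromℕ i)))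
                                                       (does-inject₁ (σ i) i)))
                   (cong bit (dec-true (π (fromℕ n) ≟ fromℕ n) (insert-self σ (fromℕ n)))) ⟩
    ∑ (λ i → bit (does (σ i ≟ i))) + 1                              ≡⟨ cong (_+ 1) (sym (fix≡∑ σ)) ⟩
    fix σ + 1                                                      ≡⟨ +-comm (fix σ) 1 ⟩
    suc (fix σ)                                                    ∎
    where
    open ≡-Reasoning
    π : Fin (suc n) → Fin (suc n)
    π = insert σ (fromℕ n)

module _ {n : ℕ} {σ : Fin n → Fin n} (O : Orbital σ) where

  open Orbital O

  private
    ι : Fin n → Fin (suc n)
    ι = inject₁

  isLeader-insert-inject₁ : ∀ c x → isLeader (insert σ c) (ι x) ≡ isLeader σ x
  isLeader-insert-inject₁ c x = begin
    all ≥x (orbit (insert σ c) (ι x))            ≡⟨ cong (all ≥x) (orbit-inject₁-insert σ c O x) ⟩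
    all ≥x (insertTopAfter c (map ι (orbit σ x))) ≡⟨ all-insertTopAfter ≥x (≤ᵇ-fromℕ (ι x)) c (map ι (orbit σ x)) ⟩
    all ≥x (map ι (orbit σ x))                   ≡⟨ all-map ≥x ι (orbit σ x) ⟩
    all (≥x ∘ ι) (orbit σ x)                     ≡⟨ all-cong (≤ᵇ-inject₁ x) (orbit σ x) ⟩
    isLeader σ x                                ∎
    where
    open ≡-Reasoning
    ≥x : Fin (suc n) → Bool
    ≥x y = ⌊ ι x ≤? y ⌋

  cycles-insert-inject₁ : ∀ a → cycles (insert σ (ι a)) ≡ map (insertTopAfter (ι a) ∘ map ι) (cycles σ)
  cycles-insert-inject₁ a = begin
    cycles π
      ≡⟨ cycles-suc π σ (isLeader-insert-inject₁ (ι a)) ⟩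
    map (orbit π ∘ ι) (leaders σ) ++ map (orbit π) (filter (λ x → isLeader π x Bool.≟ true) [ fromℕ n ])
      ≡⟨ cong₂ _++_ (trans (map-cong (orbit-inject₁-insert σ (ι a) O) (leaders σ)) (map-∘ (leaders σ)))
                    (cong (map (orbit π)) top-not-leader) ⟩
    map (insertTopAfter (ι a) ∘ map ι) (cycles σ) ++ []
      ≡⟨ ++-identityʳ _ ⟩
    map (insertTopAfter (ι a) ∘ map ι) (cycles σ) ∎
    where
    open ≡-Reasoning
    π : Fin (suc n) → Fin (suc n)
    π = insert σ (ι a)
    ≥top : Fin (suc n) → Bool
    ≥top y = ⌊ fromℕ n ≤? y ⌋
    w : List (Fin n)
    w = walk σ a (σ a) n
    top-not-leader : filter (λ x → isLeader π x Bool.≟ true) [ fromℕ n ] ≡ []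
    top-not-leader = filter-[]-reject (isLeader π) {fromℕ n} (begin
      all ≥top (orbit π (fromℕ n))                        ≡⟨ cong (all ≥top) (orbit-fromℕ-insert-inject₁ σ a O) ⟩
      ≥top (fromℕ n) ∧ all ≥top (map ι w ++ [ ι a ])      ≡⟨ cong₂ _∧_ (≤ᵇ-fromℕ (fromℕ n)) (all-++ ≥top (map ι w) [ ι a ]) ⟩
      all ≥top (map ι w) ∧ (≥top (ι a) ∧ true)            ≡⟨ cong (λ b → all ≥top (map ι w) ∧ (b ∧ true)) (fromℕ≰ᵇinject₁ a) ⟩
      all ≥top (map ι w) ∧ false                          ≡⟨ ∧-zeroʳ (all ≥top (map ι w)) ⟩
      false                                               ∎)

  cycles-insert-fromℕ : cycles (insert σ (fromℕ n)) ≡ map (map ι) (cycles σ) ++ [ [ fromℕ n ] ]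
  cycles-insert-fromℕ = begin
    cycles π
      ≡⟨ cycles-suc π σ (isLeader-insert-inject₁ (fromℕ n)) ⟩
    map (orbit π ∘ ι) (leaders σ) ++ map (orbit π) (filter (λ x → isLeader π x Bool.≟ true) [ fromℕ n ])
      ≡⟨ cong₂ _++_ (map-cong (λ x → trans (orbit-inject₁-insert σ (fromℕ n) O x) (insertTopAfter-fromℕ-map-inject₁ (orbit σ x)))
                              (leaders σ))
                    (cong (map (orbit π)) top-leader) ⟩
    map (map ι ∘ orbit σ) (leaders σ) ++ [ orbit π (fromℕ n) ]
      ≡⟨ cong₂ _++_ (map-∘ (leaders σ)) (cong [_] (orbit-fromℕ-insert-fromℕ σ)) ⟩
    map (map ι) (cycles σ) ++ [ [ fromℕ n ] ] ∎
    where
    open ≡-Reasoning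
    π : Fin (suc n) → Fin (suc n)
    π = insert σ (fromℕ n)
    top-leader : filter (λ x → isLeader π x Bool.≟ true) [ fromℕ n ] ≡ [ fromℕ n ]
    top-leader = filter-[]-accept (isLeader π) {fromℕ n}
      (trans (cong (all (λ y → ⌊ fromℕ n ≤? y ⌋)) (orbit-fromℕ-insert-fromℕ σ)) (cong (_∧ true) (≤ᵇ-fromℕ (fromℕ n))))

  cyc-insert-inject₁ : ∀ a → cyc (insert σ (ι a)) ≡ cyc σ
  cyc-insert-inject₁ a = trans (cong length (cycles-insert-inject₁ a)) (length-map _ (cycles σ))

  cyc-insert-fromℕ : cyc (insert σ (fromℕ n)) ≡ suc (cyc σ)
  cyc-insert-fromℕ = begin
    cyc (insert σ (fromℕ n))                        ≡⟨ cong length cycles-insert-fromℕ ⟩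
    length (map (map ι) (cycles σ) ++ [ [ fromℕ n ] ]) ≡⟨ length-++ (map (map ι) (cycles σ)) ⟩
    length (map (map ι) (cycles σ)) + 1              ≡⟨ cong (_+ 1) (length-map _ (cycles σ)) ⟩
    cyc σ + 1                                       ≡⟨ +-comm (cyc σ) 1 ⟩
    suc (cyc σ)                                     ∎
    where open ≡-Reasoning

module _ {n : ℕ} where

  private
    ι : Fin n → Fin (suc n)
    ι = inject₁

  concat-insertTopAfter : ∀ (c : Fin (suc n)) Ls → concat (map (insertTopAfter c) Ls) ≡ insertTopAfter c (concat Ls)
  concat-insertTopAfter c []       = refl
  concat-insertTopAfter c (L ∷ Ls) =
    trans (cong (insertTopAfter c L ++_) (concat-insertTopAfter c Ls)) (sym (insertTopAfter-++ c L (concat Ls)))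

  occurrences-snoc : ∀ (b a : Fin n) w → occurrences b (w ++ [ a ]) ≡ occurrences b (a ∷ w)
  occurrences-snoc b a w = trans (occurrences-++ b w [ a ])
    (trans (cong (λ y → occurrences b w + y) (+-identityʳ (bit (does (a ≟ b))))) (+-comm (occurrences b w) _))

  module _ {L : List (Fin n)} (simple : ∀ a → occurrences a L ≤ 1) where

    occurrences-map-inject₁≤1 : ∀ A → occurrences A (map ι L) ≤ 1
    occurrences-map-inject₁≤1 A with fromℕ-or-inject₁ A
    ... | inj₁ refl       = ≤-trans (≤-reflexive (occurrences-fromℕ-map-inject₁ L)) z≤n
    ... | inj₂ (b , refl) = subst (_≤ 1) (sym (occurrences-map-inject₁ b L)) (simple b)

    occurrences-fromℕ∷map-inject₁≤1 : ∀ A → occurrences A (fromℕ n ∷ map ι L) ≤ 1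
    occurrences-fromℕ∷map-inject₁≤1 A with fromℕ-or-inject₁ A
    ... | inj₁ refl rewrite dec-true (fromℕ n ≟ fromℕ n) refl | occurrences-fromℕ-map-inject₁ L = s≤s z≤n
    ... | inj₂ (b , refl) rewrite dec-false (fromℕ n ≟ ι b) fromℕ≢inject₁ = occurrences-map-inject₁≤1 (ι b)

    occurrences-insertTopAfter-map-inject₁≤1 : ∀ c A → occurrences A (insertTopAfter c (map ι L)) ≤ 1
    occurrences-insertTopAfter-map-inject₁≤1 c A with fromℕ-or-inject₁ A
    ... | inj₁ refl rewrite occurrences-insertTopAfter-fromℕ c (map ι L) | occurrences-fromℕ-map-inject₁ L =
      occurrences-map-inject₁≤1 c
    ... | inj₂ (b , refl) rewrite occurrences-insertTopAfter-inject₁ c b (map ι L) = occurrences-map-inject₁≤1 (ι b)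

  module _ {L : List (Fin n)} (once : ∀ a → occurrences a L ≡ 1) where

    occurrences-insertTopAfter-once : ∀ a A → occurrences A (insertTopAfter (ι a) (map ι L)) ≡ 1
    occurrences-insertTopAfter-once a A with fromℕ-or-inject₁ A
    ... | inj₂ (b , refl) rewrite occurrences-insertTopAfter-inject₁ (ι a) b (map ι L)
                                | occurrences-map-inject₁ b L = once b
    ... | inj₁ refl rewrite occurrences-insertTopAfter-fromℕ (ι a) (map ι L)
                          | occurrences-fromℕ-map-inject₁ L
                          | occurrences-map-inject₁ a L = once a

    occurrences-snoc-fromℕ-once : ∀ A → occurrences A (map ι L ++ [ fromℕ n ]) ≡ 1
    occurrences-snoc-fromℕ-once A rewrite occurrences-++ A (map ι L) [ fromℕ n ] with fromℕ-or-inject₁ A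
    ... | inj₂ (b , refl) rewrite occurrences-map-inject₁ b L | dec-false (fromℕ n ≟ ι b) fromℕ≢inject₁ =
      trans (+-identityʳ _) (once b)
    ... | inj₁ refl rewrite occurrences-fromℕ-map-inject₁ L | dec-true (fromℕ n ≟ fromℕ n) refl = refl

  concat-insertTopAfter-map : ∀ a (Cs : List (List (Fin n))) →
                              concat (map (insertTopAfter (ι a) ∘ map ι) Cs) ≡ insertTopAfter (ι a) (map ι (concat Cs))
  concat-insertTopAfter-map a Cs = begin
    concat (map (insertTopAfter (ι a) ∘ map ι) Cs)          ≡⟨ cong concat (map-∘ Cs) ⟩
    concat (map (insertTopAfter (ι a)) (map (map ι) Cs))   ≡⟨ concat-insertTopAfter (ι a) (map (map ι) Cs) ⟩
    insertTopAfter (ι a) (concat (map (map ι) Cs))         ≡⟨ cong (insertTopAfter (ι a)) (concat-map Cs) ⟩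
    insertTopAfter (ι a) (map ι (concat Cs))               ∎
    where open ≡-Reasoning

  concat-newCycle : ∀ (Cs : List (List (Fin n))) → concat (map (map ι) Cs ++ [ [ fromℕ n ] ]) ≡ map ι (concat Cs) ++ [ fromℕ n ]
  concat-newCycle Cs = trans (sym (concat-++ (map (map ι) Cs) [ [ fromℕ n ] ]))
                             (cong (_++ [ fromℕ n ]) (concat-map Cs))

Orbital-insert : ∀ {n} {σ : Fin n → Fin n} → Orbital σ → ∀ c → Orbital (insert σ c)
Orbital-insert {n} {σ} O c = record
  { orbit-closes = closes ; orbit-simple = simple ; cycles-partition = partition }
  where
  open Orbital O
  π : Fin (suc n) → Fin (suc n)
  π = insert σ c

  closes : ∀ X → Reaches π X (π X) (suc n)
  closes X with fromℕ-or-inject₁ X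
  ... | inj₂ (x , refl) = Reaches-inject₁-insert σ c O x
  ... | inj₁ refl with fromℕ-or-inject₁ c
  ...   | inj₂ (a , refl) = Reaches-fromℕ-insert-inject₁ σ a O
  ...   | inj₁ refl       = subst (λ z → Reaches π (fromℕ n) z (suc n)) (sym (insert-self σ (fromℕ n))) here

  simple : ∀ X A → occurrences A (orbit π X) ≤ 1
  simple X A with fromℕ-or-inject₁ X
  ... | inj₂ (x , refl) = subst (λ L → occurrences A L ≤ 1) (sym (orbit-inject₁-insert σ c O x))
                                (occurrences-insertTopAfter-map-inject₁≤1 {L = orbit σ x} (orbit-simple x) c A)
  ... | inj₁ refl with fromℕ-or-inject₁ c
  ...   | inj₁ refl = subst (λ L → occurrences A L ≤ 1) (sym (orbit-fromℕ-insert-fromℕ σ))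
                            (occurrences-fromℕ∷map-inject₁≤1 {L = []} (λ _ → z≤n) A)
  ...   | inj₂ (a , refl) = subst (λ L → occurrences A L ≤ 1)
                                  (sym (trans (orbit-fromℕ-insert-inject₁ σ a O) (cong (fromℕ n ∷_) (sym (map-++ inject₁ w [ a ])))))
                                  (occurrences-fromℕ∷map-inject₁≤1 {L = w ++ [ a ]} (λ b → subst (_≤ 1) (sym (occurrences-snoc b a w)) (orbit-simple a b)) A)
    where
      w : List (Fin n)
      w = walk σ a (σ a) n

  partition : ∀ A → occurrences A (concat (cycles π)) ≡ 1
  partition A with fromℕ-or-inject₁ c
  ... | inj₂ (a , refl) = subst (λ L → occurrences A L ≡ 1)
                                (sym (trans (cong concat (cycles-insert-inject₁ O a)) (concat-insertTopAfter-map a (cycles σ))))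
                                (occurrences-insertTopAfter-once {L = concat (cycles σ)} cycles-partition a A)
  ... | inj₁ refl       = subst (λ L → occurrences A L ≡ 1)
                                (sym (trans (cong concat (cycles-insert-fromℕ O)) (concat-newCycle (cycles σ))))
                                (occurrences-snoc-fromℕ-once {L = concat (cycles σ)} cycles-partition A)

Orbital-cong : ∀ {m} {π π' : Fin m → Fin m} → (∀ x → π x ≡ π' x) → Orbital π → Orbital π'
Orbital-cong {m} {π} {π'} π≗π' O = record
  { orbit-closes     = λ x → subst (λ z → Reaches π' x z m) (π≗π' x) (Reaches-cong π≗π' (orbit-closes x))
  ; orbit-simple     = λ x a → subst (λ L → occurrences a L ≤ 1) (orbit-cong π≗π' x) (orbit-simple x a)
  ; cycles-partition = λ a → subst (λ Cs → occurrences a (concat Cs) ≡ 1) (cycles-cong π≗π') (cycles-partition a)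
  }
  where open Orbital O

-- Every permutation arises by inserting n+1 into a permutation of [n].
Orbital-permutation : ∀ n (π : Fin n → Fin n) → Injective _≡_ _≡_ π → StrictlySurjective _≡_ π → Orbital π
Orbital-permutation zero    π _   _    = record { orbit-closes = λ () ; orbit-simple = λ () ; cycles-partition = λ () }
Orbital-permutation (suc n) π inj surj =
  Orbital-cong (insert-delete inj πc≡top) (Orbital-insert (Orbital-permutation n (delete π c) σ-inj σ-surj) c)
  where
  c : Fin (suc n)
  c = proj₁ (surj (fromℕ n))
  πc≡top : π c ≡ fromℕ n
  πc≡top = proj₂ (surj (fromℕ n))
  σ-inj : Injective _≡_ _≡_ (delete π c)
  σ-inj = delete-injective inj πc≡top
  σ-surj : StrictlySurjective _≡_ (delete π c)
  σ-surj = delete-surjective inj πc≡top surj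

module _ {m : ℕ} where

  isPeak : Fin m → Fin m → Fin m → Bool
  isPeak u x y = ⌊ u <? x ⌋ ∧ ⌊ y <? x ⌋

  headPeak : Fin m → List (Fin m) → Bool
  headPeak u (x ∷ y ∷ _) = isPeak u x y
  headPeak u _           = false

  peaksOf-cons : ∀ u D → peaksOf (u ∷ D) ≡ bit (headPeak u D) + peaksOf D
  peaksOf-cons u []          = refl
  peaksOf-cons u (x ∷ [])    = refl
  peaksOf-cons u (x ∷ y ∷ D) = refl

  module _ (a : Fin m) where

    lostPeaks : List (Fin m) → ℕ
    lostPeaks (u ∷ x ∷ D) = bit ((does (u ≟ a) ∨ does (x ≟ a)) ∧ headPeak u (x ∷ D)) + lostPeaks (x ∷ D)
    lostPeaks _           = 0

    innerOccurrences : List (Fin m) → ℕ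
    innerOccurrences (u ∷ x ∷ D) = bit (does (u ≟ a)) + innerOccurrences (x ∷ D)
    innerOccurrences _           = 0

  <ᵇ-irrefl : ∀ (u : Fin m) → ⌊ u <? u ⌋ ≡ false
  <ᵇ-irrefl u = trans (isYes≗does (u <? u)) (dec-false (u <? u) (n≮n (toℕ u)))

  isPeak-distinct : ∀ u x y → isPeak u x y ≡ true → u ≢ x
  isPeak-distinct u x y peak refl with trans (sym (cong (_∧ ⌊ y <? u ⌋) (<ᵇ-irrefl u))) peak
  ... | ()

+-rearrange : ∀ {P L Q I} k h k' h' → k + h ≡ k' + h' → P + L ≡ Q + I → k + P + (h + L) ≡ k' + Q + (h' + I)
+-rearrange {P} {L} {Q} {I} k h k' h' eq₁ eq₂ = begin
  k + P + (h + L)     ≡⟨ shuffle k P h L ⟩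
  (k + h) + (P + L)   ≡⟨ cong₂ _+_ eq₁ eq₂ ⟩
  (k' + h') + (Q + I) ≡⟨ sym (shuffle k' Q h' I) ⟩
  k' + Q + (h' + I)   ∎
  where
  open ≡-Reasoning
  shuffle : ∀ a b c d → a + b + (c + d) ≡ (a + c) + (b + d)
  shuffle = solve-∀

module _ {n : ℕ} where

  <ᵇ-inject₁ : ∀ (x y : Fin n) → ⌊ inject₁ x <? inject₁ y ⌋ ≡ ⌊ x <? y ⌋
  <ᵇ-inject₁ x y rewrite toℕ-inject₁ x | toℕ-inject₁ y = refl

  inject₁<ᵇfromℕ : ∀ (x : Fin n) → ⌊ inject₁ x <? fromℕ n ⌋ ≡ true
  inject₁<ᵇfromℕ x = trans (isYes≗does (inject₁ x <? fromℕ n))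
    (dec-true (inject₁ x <? fromℕ n) (subst₂ (λ i j → suc i ≤ j) (sym (toℕ-inject₁ x)) (sym (toℕ-fromℕ n)) (toℕ<n x)))

  fromℕ≮ᵇ : ∀ (x : Fin (suc n)) → ⌊ fromℕ n <? x ⌋ ≡ false
  fromℕ≮ᵇ x = trans (isYes≗does (fromℕ n <? x))
    (dec-false (fromℕ n <? x) λ lt → <⇒≱ lt (subst (toℕ x ≤_) (sym (toℕ-fromℕ n)) (ℕ.≤-pred (toℕ<n x))))

  isPeak-inject₁ : ∀ (u x y : Fin n) → isPeak (inject₁ u) (inject₁ x) (inject₁ y) ≡ isPeak u x y
  isPeak-inject₁ u x y = cong₂ _∧_ (<ᵇ-inject₁ u x) (<ᵇ-inject₁ y x)

  peaksOf-fromℕ∷ : ∀ L → peaksOf (fromℕ n ∷ L) ≡ peaksOf L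
  peaksOf-fromℕ∷ []          = refl
  peaksOf-fromℕ∷ (x ∷ [])    = refl
  peaksOf-fromℕ∷ (x ∷ y ∷ L) = cong (λ b → bit (b ∧ ⌊ y <? x ⌋) + peaksOf (x ∷ y ∷ L)) (fromℕ≮ᵇ x)

module _ {n : ℕ} (a : Fin n) where

  private
    ι : Fin n → Fin (suc n)
    ι = inject₁
    N : List (Fin n) → List (Fin (suc n))
    N = insertTopAfter (ι a) ∘ map ι

  N-match : ∀ {u} D → u ≡ a → N (u ∷ D) ≡ ι u ∷ fromℕ n ∷ N D
  N-match D u≡a = insertTopAfter-match (ι a) (map ι D) (cong ι u≡a)

  N-skip : ∀ {u} D → u ≢ a → N (u ∷ D) ≡ ι u ∷ N D
  N-skip D u≢a = insertTopAfter-skip (ι a) (map ι D) (u≢a ∘ inject₁-injective)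

  headPeak-N : ∀ u y E → y ≢ a → headPeak (ι u) (N (y ∷ E)) ≡ headPeak u (y ∷ E)
  headPeak-N u y []      y≢a = cong (headPeak (ι u)) (N-skip [] y≢a)
  headPeak-N u y (z ∷ E) y≢a = trans (cong (headPeak (ι u)) (N-skip (z ∷ E) y≢a)) (isPeak-inject₁ u y z)

  -- k counts the peaks that the prefix before N (y ∷ E) adds: at n+1 if u = a, at y otherwise.
  first-entry : ∀ u y E → ∃ λ k → peaksOf (N (u ∷ y ∷ E)) ≡ k + peaksOf (N (y ∷ E)) ×
                k + bit ((does (u ≟ a) ∨ does (y ≟ a)) ∧ headPeak u (y ∷ E)) ≡ bit (headPeak u (y ∷ E)) + bit (does (u ≟ a))
  first-entry u y E with u ≟ a | y ≟ a
  ... | yes u≡a | _ = 1 , new-peak , +-comm 1 (bit (headPeak u (y ∷ E)))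
    where
    new-peak : peaksOf (N (u ∷ y ∷ E)) ≡ 1 + peaksOf (N (y ∷ E))
    new-peak = begin
      peaksOf (N (u ∷ y ∷ E))                                             ≡⟨ cong peaksOf (N-match (y ∷ E) u≡a) ⟩
      bit (isPeak (ι u) (fromℕ n) (ι y)) + peaksOf (fromℕ n ∷ N (y ∷ E))  ≡⟨ cong₂ (λ b m → bit b + m)
                                                                               (cong₂ _∧_ (inject₁<ᵇfromℕ u) (inject₁<ᵇfromℕ y))
                                                                               (peaksOf-fromℕ∷ (N (y ∷ E))) ⟩
      1 + peaksOf (N (y ∷ E))                                             ∎
      where open ≡-Reasoning
  ... | no u≢a | yes y≡a = 0 , no-peak , sym (+-identityʳ (bit (headPeak u (y ∷ E))))
    where
    no-peak : peaksOf (N (u ∷ y ∷ E)) ≡ peaksOf (N (y ∷ E))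
    no-peak = begin
      peaksOf (N (u ∷ y ∷ E))                                              ≡⟨ cong peaksOf (N-skip (y ∷ E) u≢a) ⟩
      peaksOf (ι u ∷ N (y ∷ E))                                            ≡⟨ cong (λ L → peaksOf (ι u ∷ L)) (N-match E y≡a) ⟩
      bit (isPeak (ι u) (ι y) (fromℕ n)) + peaksOf (ι y ∷ fromℕ n ∷ N E)   ≡⟨ cong₂ (λ b m → bit b + m)
                                                                                (trans (cong (⌊ ι u <? ι y ⌋ ∧_) (fromℕ≮ᵇ (ι y))) (∧-zeroʳ _))
                                                                                (cong peaksOf (sym (N-match E y≡a))) ⟩
      peaksOf (N (y ∷ E))                                                  ∎
      where open ≡-Reasoning
  ... | no u≢a | no y≢a = bit (headPeak u (y ∷ E)) , same-peak , refl
    where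
    same-peak : peaksOf (N (u ∷ y ∷ E)) ≡ bit (headPeak u (y ∷ E)) + peaksOf (N (y ∷ E))
    same-peak = begin
      peaksOf (N (u ∷ y ∷ E))                                      ≡⟨ cong peaksOf (N-skip (y ∷ E) u≢a) ⟩
      peaksOf (ι u ∷ N (y ∷ E))                                    ≡⟨ peaksOf-cons (ι u) (N (y ∷ E)) ⟩
      bit (headPeak (ι u) (N (y ∷ E))) + peaksOf (N (y ∷ E))       ≡⟨ cong (λ b → bit b + peaksOf (N (y ∷ E))) (headPeak-N u y E y≢a) ⟩
      bit (headPeak u (y ∷ E)) + peaksOf (N (y ∷ E))               ∎
      where open ≡-Reasoning

  -- Inserting n+1 after a creates a peak at n+1 for every inner occurrence of a, and destroys the peaks at a or just after a.
  peaksOf-insertTopAfter-cons : ∀ u D → peaksOf (N (u ∷ D)) + lostPeaks a (u ∷ D) ≡ peaksOf (u ∷ D) + innerOccurrences a (u ∷ D)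
  peaksOf-insertTopAfter-cons u [] with u ≟ a
  ... | yes u≡a = cong (λ L → peaksOf L + 0) (N-match [] u≡a)
  ... | no  u≢a = cong (λ L → peaksOf L + 0) (N-skip [] u≢a)
  peaksOf-insertTopAfter-cons u (y ∷ E) with first-entry u y E
  ... | k , shape , balance = begin
    peaksOf (N (u ∷ y ∷ E)) + (bit lost-here + lostPeaks a (y ∷ E))
      ≡⟨ cong (_+ (bit lost-here + lostPeaks a (y ∷ E))) shape ⟩
    k + peaksOf (N (y ∷ E)) + (bit lost-here + lostPeaks a (y ∷ E))
      ≡⟨ +-rearrange k (bit lost-here) (bit h) (bit (does (u ≟ a))) balance (peaksOf-insertTopAfter-cons y E) ⟩
    bit h + peaksOf (y ∷ E) + (bit (does (u ≟ a)) + innerOccurrences a (y ∷ E))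
      ≡⟨ cong (_+ (bit (does (u ≟ a)) + innerOccurrences a (y ∷ E))) (sym (peaksOf-cons u (y ∷ E))) ⟩
    peaksOf (u ∷ y ∷ E) + innerOccurrences a (u ∷ y ∷ E) ∎
    where
    open ≡-Reasoning
    h : Bool
    h = headPeak u (y ∷ E)
    lost-here : Bool
    lost-here = (does (u ≟ a) ∨ does (y ≟ a)) ∧ h

  peaksOf-insertTopAfter : ∀ L → peaksOf (N L) + lostPeaks a L ≡ peaksOf L + innerOccurrences a L
  peaksOf-insertTopAfter []      = refl
  peaksOf-insertTopAfter (u ∷ D) = peaksOf-insertTopAfter-cons u D

peaksOf-map-inject₁ : ∀ {n} (L : List (Fin n)) → peaksOf (map inject₁ L) ≡ peaksOf L
peaksOf-map-inject₁ []              = refl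
peaksOf-map-inject₁ (u ∷ [])        = refl
peaksOf-map-inject₁ (u ∷ x ∷ [])    = refl
peaksOf-map-inject₁ (u ∷ x ∷ y ∷ L) = cong₂ _+_ (cong bit (isPeak-inject₁ u x y)) (peaksOf-map-inject₁ (x ∷ y ∷ L))

module _ {m : ℕ} where

  isPeak-self : ∀ (u y : Fin m) → isPeak u u y ≡ false
  isPeak-self u y = cong (_∧ ⌊ y <? u ⌋) (<ᵇ-irrefl u)

  peak-then-no-peak : ∀ (u y z : Fin m) E → bit (isPeak u y z) + bit (headPeak y (z ∷ E)) ≤ 1
  peak-then-no-peak u y z []      = ≤-trans (≤-reflexive (+-identityʳ _)) (bit≤1 _)
  peak-then-no-peak u y z (w ∷ E) with z <? y | y <? z
  ... | yes z<y | yes y<z = ⊥-elim (<-asym z<y y<z)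
  ... | no _    | _       rewrite ∧-zeroʳ ⌊ u <? y ⌋ = bit≤1 _
  ... | yes _   | no _    rewrite ∧-identityʳ ⌊ u <? y ⌋ = ≤-trans (≤-reflexive (+-identityʳ _)) (bit≤1 _)

  bit-∧≤ : ∀ b c → bit (b ∧ c) ≤ bit b
  bit-∧≤ true  c = bit≤1 c
  bit-∧≤ false c = z≤n

  module _ (a : Fin m) where

    -- The last term is the peak right after u, still to be paid for by u when u = a.
    lostPeaks≤ : ∀ u D → lostPeaks a (u ∷ D) ≤ innerOccurrences a D + bit (does (u ≟ a) ∧ headPeak u D)
    lostPeaks≤ u []           = z≤n
    lostPeaks≤ u (y ∷ [])     = ≤-reflexive (trans (cong (λ b → bit b + 0) (∧-zeroʳ _)) (sym (cong bit (∧-zeroʳ _))))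
    lostPeaks≤ u (y ∷ z ∷ E) = begin
      bit ((U ∨ Y) ∧ P) + lostPeaks a (y ∷ z ∷ E)                   ≤⟨ +-monoʳ-≤ (bit ((U ∨ Y) ∧ P)) (lostPeaks≤ y (z ∷ E)) ⟩
      bit ((U ∨ Y) ∧ P) + (innerOccurrences a (z ∷ E) + bit (Y ∧ Q)) ≡⟨ shuffle (bit ((U ∨ Y) ∧ P)) _ (bit (Y ∧ Q)) ⟩
      innerOccurrences a (z ∷ E) + (bit ((U ∨ Y) ∧ P) + bit (Y ∧ Q)) ≤⟨ +-monoʳ-≤ (innerOccurrences a (z ∷ E)) (charge (u ≟ a) (y ≟ a)) ⟩
      innerOccurrences a (z ∷ E) + (bit Y + bit (U ∧ P))             ≡⟨ shuffle′ (innerOccurrences a (z ∷ E)) (bit Y) (bit (U ∧ P)) ⟩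
      bit Y + innerOccurrences a (z ∷ E) + bit (U ∧ P)               ∎
      where
      open ℕ.≤-Reasoning
      U Y P Q : Bool
      U = does (u ≟ a)
      Y = does (y ≟ a)
      P = isPeak u y z
      Q = headPeak y (z ∷ E)
      shuffle : ∀ x i q → x + (i + q) ≡ i + (x + q)
      shuffle = solve-∀
      shuffle′ : ∀ i y q → i + (y + q) ≡ y + i + q
      shuffle′ = solve-∀
      charge : (u? : Dec (u ≡ a)) (y? : Dec (y ≡ a)) →
               bit ((does u? ∨ does y?) ∧ P) + bit (does y? ∧ Q) ≤ bit (does y?) + bit (does u? ∧ P)
      charge u?         (no _)    rewrite ∨-identityʳ (does u?) = ≤-reflexive (+-comm (bit (does u? ∧ P)) 0)
      charge (yes refl) (yes refl) rewrite isPeak-self u z = bit≤1 Q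
      charge (no _)     (yes _)   = peak-then-no-peak u y z E

    lostPeaks≤innerOccurrences : ∀ L → lostPeaks a L ≤ innerOccurrences a L
    lostPeaks≤innerOccurrences []          = z≤n
    lostPeaks≤innerOccurrences (u ∷ [])    = z≤n
    lostPeaks≤innerOccurrences (u ∷ y ∷ E) = ≤-trans (lostPeaks≤ u (y ∷ E))
      (≤-trans (≤-reflexive (+-comm (innerOccurrences a (y ∷ E)) _)) (+-mono-≤ (bit-∧≤ (does (u ≟ a)) _) ≤-refl))

  ∑-pair : ∀ {u x : Fin m} → u ≢ x → ∑ (λ a → bit (does (u ≟ a) ∨ does (x ≟ a))) ≡ 2
  ∑-pair {u} {x} u≢x = begin
    ∑ (λ a → bit (does (u ≟ a) ∨ does (x ≟ a)))              ≡⟨ sum-cong-≗ split ⟩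
    ∑ (λ a → bit (does (u ≟ a)) + bit (does (x ≟ a)))         ≡⟨ ∑-distrib-+ (λ a → bit (does (u ≟ a))) (λ a → bit (does (x ≟ a))) ⟩
    ∑ (λ a → bit (does (u ≟ a))) + ∑ (λ a → bit (does (x ≟ a))) ≡⟨ cong₂ _+_ (∑-indicator u) (∑-indicator x) ⟩
    2                                                        ∎
    where
    open ≡-Reasoning
    split : ∀ a → bit (does (u ≟ a) ∨ does (x ≟ a)) ≡ bit (does (u ≟ a)) + bit (does (x ≟ a))
    split a with u ≟ a | x ≟ a
    ... | yes refl | yes refl = ⊥-elim (u≢x refl)
    ... | yes _    | no _     = refl
    ... | no _     | yes _    = refl
    ... | no _     | no _     = refl

  ∑-lostPeaks-step : ∀ (u x : Fin m) D →
    ∑ (λ a → bit ((does (u ≟ a) ∨ does (x ≟ a)) ∧ headPeak u (x ∷ D))) ≡ 2 * bit (headPeak u (x ∷ D))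
  ∑-lostPeaks-step u x D with headPeak u (x ∷ D) in peak
  ... | false = trans (sum-cong-≗ {m} (λ a → cong bit (∧-zeroʳ (does (u ≟ a) ∨ does (x ≟ a))))) (sum-replicate-zero m)
  ... | true  = trans (sum-cong-≗ {m} (λ a → cong bit (∧-identityʳ (does (u ≟ a) ∨ does (x ≟ a))))) (∑-pair (distinct D peak))
    where
    distinct : ∀ D → headPeak u (x ∷ D) ≡ true → u ≢ x
    distinct (y ∷ _) = isPeak-distinct u x y

  -- Every peak is lost both when inserting after it and when inserting after its predecessor.
  ∑-lostPeaks : ∀ (L : List (Fin m)) → ∑ (λ a → lostPeaks a L) ≡ 2 * peaksOf L
  ∑-lostPeaks []          = sum-replicate-zero m
  ∑-lostPeaks (u ∷ [])    = sum-replicate-zero m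
  ∑-lostPeaks (u ∷ x ∷ D) = begin
    ∑ (λ a → bit ((does (u ≟ a) ∨ does (x ≟ a)) ∧ h) + lostPeaks a (x ∷ D))
      ≡⟨ ∑-distrib-+ (λ a → bit ((does (u ≟ a) ∨ does (x ≟ a)) ∧ h)) (λ a → lostPeaks a (x ∷ D)) ⟩
    ∑ (λ a → bit ((does (u ≟ a) ∨ does (x ≟ a)) ∧ h)) + ∑ (λ a → lostPeaks a (x ∷ D))
      ≡⟨ cong₂ _+_ (∑-lostPeaks-step u x D) (∑-lostPeaks (x ∷ D)) ⟩
    2 * bit h + 2 * peaksOf (x ∷ D)
      ≡⟨ sym (ℕ.*-distribˡ-+ 2 (bit h) (peaksOf (x ∷ D))) ⟩
    2 * (bit h + peaksOf (x ∷ D))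
      ≡⟨ cong (2 *_) (sym (peaksOf-cons u (x ∷ D))) ⟩
    2 * peaksOf (u ∷ x ∷ D) ∎
    where
    open ≡-Reasoning
    h : Bool
    h = headPeak u (x ∷ D)

  ∑-innerOccurrences : ∀ (u : Fin m) D → ∑ (λ a → innerOccurrences a (u ∷ D)) + 1 ≡ length (u ∷ D)
  ∑-innerOccurrences u []      = cong (_+ 1) (sum-replicate-zero m)
  ∑-innerOccurrences u (x ∷ D) = begin
    ∑ (λ a → bit (does (u ≟ a)) + innerOccurrences a (x ∷ D)) + 1
      ≡⟨ cong (_+ 1) (∑-distrib-+ (λ a → bit (does (u ≟ a))) (λ a → innerOccurrences a (x ∷ D))) ⟩
    ∑ (λ a → bit (does (u ≟ a))) + ∑ (λ a → innerOccurrences a (x ∷ D)) + 1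
      ≡⟨ cong (λ k → k + ∑ (λ a → innerOccurrences a (x ∷ D)) + 1) (∑-indicator u) ⟩
    suc (∑ (λ a → innerOccurrences a (x ∷ D)) + 1)
      ≡⟨ cong suc (∑-innerOccurrences x D) ⟩
    length (u ∷ x ∷ D) ∎
    where open ≡-Reasoning

module _ {A : Set} where

  sum-map-const-1 : ∀ (xs : List A) → sum (map (λ _ → 1) xs) ≡ length xs
  sum-map-const-1 []       = refl
  sum-map-const-1 (x ∷ xs) = cong suc (sum-map-const-1 xs)

  ∈⇒≤sum : ∀ (f : A → ℕ) {x xs} → x ∈ xs → f x ≤ sum (map f xs)
  ∈⇒≤sum f {xs = y ∷ ys} (here refl) = m≤m+n (f y) _
  ∈⇒≤sum f {xs = y ∷ ys} (there x∈) = ≤-trans (∈⇒≤sum f x∈) (m≤n+m _ (f y))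

module _ {m : ℕ} (a : Fin m) where

  endsWith : List (Fin m) → ℕ
  endsWith []          = 0
  endsWith (x ∷ [])    = bit (does (x ≟ a))
  endsWith (x ∷ y ∷ L) = endsWith (y ∷ L)

  innerOccurrences+endsWith : ∀ L → innerOccurrences a L + endsWith L ≡ occurrences a L
  innerOccurrences+endsWith []          = refl
  innerOccurrences+endsWith (x ∷ [])    = sym (+-identityʳ (bit (does (x ≟ a))))
  innerOccurrences+endsWith (x ∷ y ∷ L) =
    trans (+-assoc (bit (does (x ≟ a))) _ _) (cong (λ m → bit (does (x ≟ a)) + m) (innerOccurrences+endsWith (y ∷ L)))

module Statistics {n : ℕ} {σ : Fin n → Fin n} (O : Orbital σ) where

  open Orbital O

  private
    Cs : List (List (Fin n))
    Cs = cycles σ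

  gained : Fin n → ℕ
  gained a = sum (map (innerOccurrences a) Cs)

  lost : Fin n → ℕ
  lost a = sum (map (lostPeaks a) Cs)

  newPeaks : Fin n → ℕ
  newPeaks a = gained a ∸ lost a

  lost≤gained : ∀ a → lost a ≤ gained a
  lost≤gained a = sum-map-mono (lostPeaks≤innerOccurrences a) Cs

  cpk-insert-inject₁ : ∀ a → cpk (insert σ (inject₁ a)) ≡ cpk σ + newPeaks a
  cpk-insert-inject₁ a = +-cancelʳ-≡ (lost a) _ _ (begin
    cpk (insert σ (inject₁ a)) + lost a
      ≡⟨ cong (λ Ds → sum (map peaksOf Ds) + lost a) (cycles-insert-inject₁ O a) ⟩
    sum (map peaksOf (map N Cs)) + lost a
      ≡⟨ cong (_+ lost a) (cong sum (sym (map-∘ Cs))) ⟩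
    sum (map (peaksOf ∘ N) Cs) + sum (map (lostPeaks a) Cs)
      ≡⟨ sym (sum-map-+ (peaksOf ∘ N) (lostPeaks a) Cs) ⟩
    sum (map (λ C → peaksOf (N C) + lostPeaks a C) Cs)
      ≡⟨ sum-map-cong (peaksOf-insertTopAfter a) Cs ⟩
    sum (map (λ C → peaksOf C + innerOccurrences a C) Cs)
      ≡⟨ sum-map-+ peaksOf (innerOccurrences a) Cs ⟩
    cpk σ + gained a
      ≡⟨ cong (λ y → cpk σ + y) (sym (m∸n+n≡m (lost≤gained a))) ⟩
    cpk σ + (newPeaks a + lost a)
      ≡⟨ sym (+-assoc (cpk σ) (newPeaks a) (lost a)) ⟩
    cpk σ + newPeaks a + lost a ∎)
    where
    open ≡-Reasoning
    N = insertTopAfter (inject₁ a) ∘ map inject₁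

  cpk-insert-fromℕ : cpk (insert σ (fromℕ n)) ≡ cpk σ
  cpk-insert-fromℕ = begin
    sum (map peaksOf (cycles (insert σ (fromℕ n))))
      ≡⟨ cong (sum ∘ map peaksOf) (cycles-insert-fromℕ O) ⟩
    sum (map peaksOf (map (map inject₁) Cs ++ [ [ fromℕ n ] ]))
      ≡⟨ cong sum (map-++ peaksOf (map (map inject₁) Cs) [ [ fromℕ n ] ]) ⟩
    sum (map peaksOf (map (map inject₁) Cs) ++ [ 0 ])
      ≡⟨ sum-++ (map peaksOf (map (map inject₁) Cs)) [ 0 ] ⟩
    sum (map peaksOf (map (map inject₁) Cs)) + 0
      ≡⟨ +-identityʳ _ ⟩
    sum (map peaksOf (map (map inject₁) Cs))
      ≡⟨ cong sum (sym (map-∘ Cs)) ⟩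
    sum (map (peaksOf ∘ map inject₁) Cs)
      ≡⟨ sum-map-cong peaksOf-map-inject₁ Cs ⟩
    cpk σ ∎
    where open ≡-Reasoning

  ∑-lost : ∑ lost ≡ 2 * cpk σ
  ∑-lost = begin
    ∑ (λ a → sum (map (lostPeaks a) Cs))          ≡⟨ ∑-sum-comm lostPeaks Cs ⟩
    sum (map (λ C → ∑ (λ a → lostPeaks a C)) Cs)  ≡⟨ sum-map-cong ∑-lostPeaks Cs ⟩
    sum (map (λ C → 2 * peaksOf C) Cs)            ≡⟨ sum-map-*ˡ 2 peaksOf Cs ⟩
    2 * cpk σ                                     ∎
    where open ≡-Reasoning

  ∑-gained : ∑ gained + cyc σ ≡ n
  ∑-gained = begin
    ∑ (λ a → sum (map (innerOccurrences a) Cs)) + length Cs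
      ≡⟨ cong₂ _+_ (∑-sum-comm innerOccurrences Cs) (sym (sum-map-const-1 Cs)) ⟩
    sum (map inner Cs) + sum (map (λ _ → 1) Cs)
      ≡⟨ sym (sum-map-+ inner (λ _ → 1) Cs) ⟩
    sum (map (λ C → inner C + 1) (map (orbit σ) (leaders σ)))
      ≡⟨ cong sum (sym (map-∘ (leaders σ))) ⟩
    sum (map (λ x → inner (orbit σ x) + 1) (leaders σ))
      ≡⟨ sum-map-cong (λ x → ∑-innerOccurrences x (walk σ x (σ x) n)) (leaders σ) ⟩
    sum (map (length ∘ orbit σ) (leaders σ))
      ≡⟨ cong sum (map-∘ (leaders σ)) ⟩
    sum (map length Cs)
      ≡⟨ sum-map-cong (λ C → sym (∑-occurrences C)) Cs ⟩
    sum (map (λ C → ∑ (λ a → occurrences a C)) Cs)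
      ≡⟨ sym (∑-sum-comm occurrences Cs) ⟩
    ∑ (λ a → sum (map (occurrences a) Cs))
      ≡⟨ sum-cong-≗ (λ a → trans (sym (occurrences-concat a Cs)) (cycles-partition a)) ⟩
    ∑ {n} (λ _ → 1)
      ≡⟨ ∑-one n ⟩
    n ∎
    where
    open ≡-Reasoning
    inner : List (Fin n) → ℕ
    inner = λ C → ∑ (λ a → innerOccurrences a C)

  -- Each of the n - cyc σ inner entries gains a peak after it, and each peak is lost twice.
  ∑-newPeaks : ∑ newPeaks + cyc σ + 2 * cpk σ ≡ n
  ∑-newPeaks = begin
    ∑ newPeaks + cyc σ + 2 * cpk σ       ≡⟨ cong (λ k → ∑ newPeaks + cyc σ + k) (sym ∑-lost) ⟩
    ∑ newPeaks + cyc σ + ∑ lost          ≡⟨ shuffle (∑ newPeaks) (cyc σ) (∑ lost) ⟩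
    ∑ newPeaks + ∑ lost + cyc σ          ≡⟨ cong (_+ cyc σ) (sym (∑-distrib-+ newPeaks lost)) ⟩
    ∑ (λ a → newPeaks a + lost a) + cyc σ ≡⟨ cong (_+ cyc σ) (sum-cong-≗ (λ a → m∸n+n≡m (lost≤gained a))) ⟩
    ∑ gained + cyc σ                     ≡⟨ ∑-gained ⟩
    n                                    ∎
    where
    open ≡-Reasoning
    shuffle : ∀ x y z → x + y + z ≡ x + z + y
    shuffle = solve-∀

  gained+endsWith : ∀ a → gained a + sum (map (endsWith a) Cs) ≡ 1
  gained+endsWith a = begin
    gained a + sum (map (endsWith a) Cs)                    ≡⟨ sym (sum-map-+ (innerOccurrences a) (endsWith a) Cs) ⟩
    sum (map (λ C → innerOccurrences a C + endsWith a C) Cs) ≡⟨ sum-map-cong (innerOccurrences+endsWith a) Cs ⟩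
    sum (map (occurrences a) Cs)                            ≡⟨ sym (occurrences-concat a Cs) ⟩
    occurrences a (concat Cs)                               ≡⟨ cycles-partition a ⟩
    1                                                       ∎
    where open ≡-Reasoning

  newPeaks≤1 : ∀ a → newPeaks a ≤ 1
  newPeaks≤1 a = ≤-trans (m∸n≤m (gained a) (lost a))
                         (subst (gained a ≤_) (gained+endsWith a) (m≤m+n (gained a) _))

  -- A fixed point a forms the cycle [a], where it is the last entry.
  newPeaks-fixed : ∀ a → σ a ≡ a → newPeaks a ≡ 0
  newPeaks-fixed a σa≡a = trans (cong (_∸ lost a) gained≡0) (0∸n≡0 (lost a))
    where
    orbit-fixed : orbit σ a ≡ [ a ]
    orbit-fixed = cong (a ∷_) (walk-here σ a n σa≡a)
    leader : isLeader σ a ≡ true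
    leader = trans (cong (all (λ y → ⌊ a ≤? y ⌋)) orbit-fixed)
                   (cong (_∧ true) (trans (isYes≗does (a ≤? a)) (dec-true (a ≤? a) ℕ.≤-refl)))
    [a]∈Cs : [ a ] ∈ Cs
    [a]∈Cs = subst (_∈ Cs) orbit-fixed (∈-map⁺ (orbit σ) (∈-filter⁺ (λ x → isLeader σ x Bool.≟ true) (∈-allFin a) leader))
    ends≥1 : 1 ≤ sum (map (endsWith a) Cs)
    ends≥1 = subst (_≤ sum (map (endsWith a) Cs)) (cong bit (dec-true (a ≟ a) refl)) (∈⇒≤sum (endsWith a) [a]∈Cs)
    gained≡0 : gained a ≡ 0
    gained≡0 = n≤0⇒n≡0 (+-cancelʳ-≤ 1 (gained a) 0
                 (≤-trans (+-monoʳ-≤ (gained a) ends≥1) (≤-reflexive (gained+endsWith a))))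

module _ {m : ℕ} (f : Fin m → Fin m) where

  private
    T-all : ∀ (p : Fin m → Bool) → T (all p (allFin m)) → ∀ x → T (p x)
    T-all p t x = All.lookup (all⁺ p (allFin m) t) (∈-allFin x)

  isPerm⇒injective : isPerm f ≡ true → Injective _≡_ _≡_ f
  isPerm⇒injective e {i} {j} fi≡fj = decide (T-all _ (T-all _ (proj₁ (Equivalence.to T-∧ (Equivalence.from T-≡ e))) i) j)
    where
    decide : T (not ⌊ f i ≟ f j ⌋ ∨ ⌊ i ≟ j ⌋) → i ≡ j
    decide t with f i ≟ f j | i ≟ j
    ... | _      | yes i≡j = i≡j
    ... | no fi≢fj | no _  = ⊥-elim (fi≢fj fi≡fj)

  isPerm⇒surjective : isPerm f ≡ true → StrictlySurjective _≡_ f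
  isPerm⇒surjective e y =
    let (x , t) = Any.satisfied (any⁻ _ (allFin m) (T-all _ (proj₂ (Equivalence.to T-∧ (Equivalence.from T-≡ e))) y))
    in x , toWitness t

  bijective⇒isPerm : Injective _≡_ _≡_ f → StrictlySurjective _≡_ f → isPerm f ≡ true
  bijective⇒isPerm inj surj = Equivalence.to T-≡ (Equivalence.from T-∧
    ( all⁻ _ (All.universal (λ i → all⁻ _ (All.universal (λ j → injective-test i j) (allFin m))) (allFin m))
    , all⁻ _ (All.universal (λ y → any⁺ _ (Any.map (λ { refl → fromWitness (proj₂ (surj y)) }) (∈-allFin (proj₁ (surj y))))) (allFin m))))
    where
    injective-test : ∀ i j → T (not ⌊ f i ≟ f j ⌋ ∨ ⌊ i ≟ j ⌋)
    injective-test i j with f i ≟ f j | i ≟ j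
    ... | yes fi≡fj | no i≢j = i≢j (inj fi≡fj)
    ... | yes _     | yes _  = _
    ... | no _      | yes _  = _
    ... | no _      | no _   = _

-- Functions are listed through their tables, which unlike functions can be compared for equality.
table : ∀ {k m} → (Fin k → Fin m) → Vec (Fin m) k
table = Vec.tabulate

cartesianProductWith-map : ∀ {A B C X : Set} (h : B → A → C) (e : X → B) (xs : List X) (ys : List A) →
  cartesianProductWith h (map e xs) ys ≡ concat (map (λ x → map (h (e x)) ys) xs)
cartesianProductWith-map h e []       ys = refl
cartesianProductWith-map h e (x ∷ xs) ys = cong (map (h (e x)) ys ++_) (cartesianProductWith-map h e xs ys)

table-allFuns-suc : ∀ k m → map table (allFuns (suc k) m) ≡
                           cartesianProductWith (λ v x → x Vec.∷ v) (map table (allFuns k m)) (allFin m)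
table-allFuns-suc k m = begin
  map table (concat (map (λ f → map (λ x → x ∷ᶠ f) (allFin m)) (allFuns k m)))
    ≡⟨ sym (concat-map (map (λ f → map (λ x → x ∷ᶠ f) (allFin m)) (allFuns k m))) ⟩
  concat (map (map table) (map (λ f → map (λ x → x ∷ᶠ f) (allFin m)) (allFuns k m)))
    ≡⟨ cong concat (sym (map-∘ (allFuns k m))) ⟩
  concat (map (λ f → map table (map (λ x → x ∷ᶠ f) (allFin m))) (allFuns k m))
    ≡⟨ cong concat (map-cong (λ f → sym (map-∘ (allFin m))) (allFuns k m)) ⟩
  concat (map (λ f → map (λ x → x Vec.∷ table f) (allFin m)) (allFuns k m))
    ≡⟨ sym (cartesianProductWith-map (λ v x → x Vec.∷ v) table (allFuns k m) (allFin m)) ⟩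
  cartesianProductWith (λ v x → x Vec.∷ v) (map table (allFuns k m)) (allFin m) ∎
  where open ≡-Reasoning

unique-allFuns : ∀ k m → Unique (map table (allFuns k m))
unique-allFuns zero    m = All.[] ∷ []
unique-allFuns (suc k) m = subst Unique (sym (table-allFuns-suc k m))
  (Unique.cartesianProductWith⁺ (λ v x → x Vec.∷ v) (λ eq → let (x≡y , v≡w) = Vec.∷-injective eq in v≡w , x≡y)
                                (unique-allFuns k m) (Unique.allFin⁺ m))

unique-map-filter : ∀ {A B : Set} (f : A → B) {P : A → Set} (P? : Decidable P) xs →
                    Unique (map f xs) → Unique (map f (filter P? xs))
unique-map-filter f P? []       u = u
unique-map-filter f P? (x ∷ xs) (x∉ ∷ u) with does (P? x)
... | true  = All.map⁺ (All.filter⁺ P? (All.map⁻ x∉)) ∷ unique-map-filter f P? xs u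
... | false = unique-map-filter f P? xs u

allFuns-complete : ∀ k m (f : Fin k → Fin m) → ∃ λ g → g ∈ allFuns k m × (∀ i → g i ≡ f i)
allFuns-complete zero    m f = (λ ()) , here refl , (λ ())
allFuns-complete (suc k) m f with allFuns-complete k m (f ∘ suc)
... | g , g∈ , g≗f = (f zero ∷ᶠ g) ,
      ∈-concatMap⁺ (λ h → map (λ x → x ∷ᶠ h) (allFin m)) (Any.map (λ { refl → ∈-map⁺ (λ x → x ∷ᶠ _) (∈-allFin (f zero)) }) g∈) ,
      (λ { zero → refl ; (suc i) → g≗f i })

module _ {m : ℕ} where

  perms-sound : ∀ {g : Fin m → Fin m} → g ∈ perms m → Injective _≡_ _≡_ g × StrictlySurjective _≡_ g
  perms-sound {g} g∈ = let isPerm-g = proj₂ (∈-filter⁻ (λ f → isPerm f Bool.≟ true) {xs = allFuns m m} g∈)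
                       in isPerm⇒injective g isPerm-g , isPerm⇒surjective g isPerm-g

  perms-complete : ∀ (f : Fin m → Fin m) → Injective _≡_ _≡_ f → StrictlySurjective _≡_ f →
                   ∃ λ g → g ∈ perms m × (∀ i → g i ≡ f i)
  perms-complete f inj surj with allFuns-complete m m f
  ... | g , g∈ , g≗f = g , ∈-filter⁺ (λ f → isPerm f Bool.≟ true) g∈ (bijective⇒isPerm g g-inj g-surj) , g≗f
    where
    g-inj : Injective _≡_ _≡_ g
    g-inj {i} {j} eq = inj (trans (sym (g≗f i)) (trans eq (g≗f j)))
    g-surj : StrictlySurjective _≡_ g
    g-surj y = let (x , fx≡y) = surj y in x , trans (g≗f x) fx≡y

module _ {n : ℕ} where

  extend-cong : ∀ {σ σ' : Fin n → Fin n} → (∀ i → σ i ≡ σ' i) → ∀ x → extend σ x ≡ extend σ' x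
  extend-cong {σ} {σ'} σ≗σ' x with fromℕ-or-inject₁ x
  ... | inj₁ refl       = trans (extend-fromℕ σ) (sym (extend-fromℕ σ'))
  ... | inj₂ (i , refl) = trans (extend-inject₁ σ i) (trans (cong inject₁ (σ≗σ' i)) (sym (extend-inject₁ σ' i)))

  insert-cong : ∀ {σ σ' : Fin n → Fin n} → (∀ i → σ i ≡ σ' i) → ∀ c x → insert σ c x ≡ insert σ' c x
  insert-cong σ≗σ' c x = extend-cong σ≗σ' (transpose c (fromℕ n) x)

  delete-cong : ∀ {π π' : Fin (suc n) → Fin (suc n)} → (∀ x → π x ≡ π' x) → ∀ c i → delete π c i ≡ delete π' c i
  delete-cong π≗π' c = restrict-cong (λ x → π≗π' (transpose c (fromℕ n) x))

  extend-fromℕ⁻¹ : ∀ (σ : Fin n → Fin n) {y} → extend σ y ≡ fromℕ n → y ≡ fromℕ n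
  extend-fromℕ⁻¹ σ {y} eq with fromℕ-or-inject₁ y
  ... | inj₁ y≡top     = y≡top
  ... | inj₂ (i , refl) = ⊥-elim (inject₁≢fromℕ (σ i) (trans (sym (extend-inject₁ σ i)) eq))

  insert-fromℕ⁻¹ : ∀ (σ : Fin n → Fin n) c {x} → insert σ c x ≡ fromℕ n → x ≡ c
  insert-fromℕ⁻¹ σ c {x} eq = begin
    x                                                       ≡⟨ sym (transpose-involutive c (fromℕ n) x) ⟩
    transpose c (fromℕ n) (transpose c (fromℕ n) x)         ≡⟨ cong (transpose c (fromℕ n)) (extend-fromℕ⁻¹ σ {transpose c (fromℕ n) x} eq) ⟩
    transpose c (fromℕ n) (fromℕ n)                         ≡⟨ transpose-matchʳ c (fromℕ n) ⟩
    c                                                       ∎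
    where open ≡-Reasoning

module _ (P : ∀ {k} → (Fin k → Fin k) → Bool)
         (P-cong : ∀ {k} {π π' : Fin k → Fin k} → (∀ x → π x ≡ π' x) → P π ≡ P π') (n : ℕ) where

  private
    holds : ∀ {k} (π : Fin k → Fin k) → Dec (P π ≡ true)
    holds π = P π Bool.≟ true

    holdsᵛ : ∀ {k} (v : Vec (Fin k) k) → Dec (P (Vec.lookup v) ≡ true)
    holdsᵛ v = holds (Vec.lookup v)

    does-holds-table : ∀ {k} (π : Fin k → Fin k) → does (holdsᵛ (table π)) ≡ does (holds π)
    does-holds-table π = cong (λ b → does (b Bool.≟ true)) (P-cong (Vec.lookup∘tabulate π))

    H : Vec (Fin n) n → Fin (suc n) → Vec (Fin (suc n)) (suc n)
    H v c = table (insert (Vec.lookup v) c)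

    H-injective : ∀ {v v' c c'} → H v c ≡ H v' c' → v ≡ v' × c ≡ c'
    H-injective {v} {v'} {c} {c'} eq = v≡v' , c≡c'
      where
      same : ∀ x → insert (Vec.lookup v) c x ≡ insert (Vec.lookup v') c' x
      same x = trans (sym (Vec.lookup∘tabulate (insert (Vec.lookup v) c) x))
                     (trans (cong (λ w → Vec.lookup w x) eq) (Vec.lookup∘tabulate (insert (Vec.lookup v') c') x))
      c≡c' : c ≡ c'
      c≡c' = insert-fromℕ⁻¹ (Vec.lookup v') c' (trans (sym (same c)) (insert-self (Vec.lookup v) c))
      v≡v' : v ≡ v'
      v≡v' = trans (sym (Vec.tabulate∘lookup v)) (trans (Vec.tabulate-cong λ i → begin
        Vec.lookup v i                                ≡⟨ sym (delete-insert (Vec.lookup v) c i) ⟩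
        delete (insert (Vec.lookup v) c) c i          ≡⟨ delete-cong same c i ⟩
        delete (insert (Vec.lookup v') c') c i        ≡⟨ cong (λ d → delete (insert (Vec.lookup v') c') d i) c≡c' ⟩
        delete (insert (Vec.lookup v') c') c' i       ≡⟨ delete-insert (Vec.lookup v') c' i ⟩
        Vec.lookup v' i                               ∎) (Vec.tabulate∘lookup v'))
        where open ≡-Reasoning

    isPerm? : ∀ {k} (f : Fin k → Fin k) → Dec (isPerm f ≡ true)
    isPerm? f = isPerm f Bool.≟ true

    Xs Ys : List (Vec (Fin (suc n)) (suc n))
    Xs = map table (perms (suc n))
    Ys = cartesianProductWith H (map table (perms n)) (allFin (suc n))

    unique-Xs : Unique Xs
    unique-Xs = unique-map-filter table isPerm? (allFuns (suc n) (suc n)) (unique-allFuns (suc n) (suc n))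

    unique-Ys : Unique Ys
    unique-Ys = Unique.cartesianProductWith⁺ H H-injective
                  (unique-map-filter table isPerm? (allFuns n n) (unique-allFuns n n)) (Unique.allFin⁺ (suc n))

    Xs⊆Ys : ∀ {v} → v ∈ Xs → v ∈ Ys
    Xs⊆Ys v∈ with ∈-map⁻ table v∈
    ... | π , π∈ , refl with perms-sound π∈
    ...   | inj , surj with surj (fromℕ n)
    ...     | c , πc≡top with perms-complete (delete π c) (delete-injective inj πc≡top) (delete-surjective inj πc≡top surj)
    ...       | σ , σ∈ , σ≗ = subst (_∈ Ys) (sym table-π)
                                    (∈-cartesianProductWith⁺ H (∈-map⁺ table σ∈) (∈-allFin c))
      where
      table-π : table π ≡ H (table σ) c
      table-π = Vec.tabulate-cong λ x → sym (trans (insert-cong (λ i → trans (Vec.lookup∘tabulate σ i) (σ≗ i)) c x)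
                                                   (insert-delete inj πc≡top x))

    Ys⊆Xs : ∀ {v} → v ∈ Ys → v ∈ Xs
    Ys⊆Xs v∈ with ∈-cartesianProductWith⁻ H (map table (perms n)) (allFin (suc n)) v∈
    ... | u , c , u∈ , _ , refl with ∈-map⁻ table u∈
    ...   | σ , σ∈ , refl with perms-sound σ∈
    ...     | inj , surj with perms-complete (insert σ c) (insert-injective inj c) (insert-surjective surj c)
    ...       | π , π∈ , π≗ = subst (_∈ Xs) table-π (∈-map⁺ table π∈)
      where
      table-π : table π ≡ H (table σ) c
      table-π = Vec.tabulate-cong λ x → trans (π≗ x) (insert-cong (λ i → sym (Vec.lookup∘tabulate σ i)) c x)

    Xs↭Ys : Xs ↭ Ys
    Xs↭Ys = ∼bag⇒↭ (unique∧set⇒bag unique-Xs unique-Ys (mk⇔ Xs⊆Ys Ys⊆Xs))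

    length-filter-concat : ∀ {A : Set} {Q : A → Set} (Q? : Decidable Q) (xss : List (List A)) →
                           length (filter Q? (concat xss)) ≡ sum (map (length ∘ filter Q?) xss)
    length-filter-concat Q? []         = refl
    length-filter-concat Q? (xs ∷ xss) = trans (cong length (filter-++ Q? xs (concat xss)))
      (trans (length-++ (filter Q? xs)) (cong (λ y → length (filter Q? xs) + y) (length-filter-concat Q? xss)))

  -- (σ , c) ↦ insert σ c is a bijection from 𝔖ₙ × [n+1] onto 𝔖ₙ₊₁.
  count-by-insertion : length (filter holds (perms (suc n))) ≡
                       sum (map (λ σ → length (filter (λ c → holds (insert σ c)) (allFin (suc n)))) (perms n))
  count-by-insertion = begin
    length (filter holds (perms (suc n)))
      ≡⟨ sym (length-map table (filter holds (perms (suc n)))) ⟩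
    length (map table (filter holds (perms (suc n))))
      ≡⟨ cong length (sym (filter-map holdsᵛ holds table does-holds-table (perms (suc n)))) ⟩
    length (filter holdsᵛ Xs)
      ≡⟨ ↭-length (filter-↭ holdsᵛ Xs↭Ys) ⟩
    length (filter holdsᵛ Ys)
      ≡⟨ cong (length ∘ filter holdsᵛ) (cartesianProductWith-map H table (perms n) (allFin (suc n))) ⟩
    length (filter holdsᵛ (concat (map (λ σ → map (H (table σ)) (allFin (suc n))) (perms n))))
      ≡⟨ length-filter-concat holdsᵛ (map (λ σ → map (H (table σ)) (allFin (suc n))) (perms n)) ⟩
    sum (map (length ∘ filter holdsᵛ) (map (λ σ → map (H (table σ)) (allFin (suc n))) (perms n)))
      ≡⟨ cong sum (sym (map-∘ (perms n))) ⟩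
    sum (map (λ σ → length (filter holdsᵛ (map (H (table σ)) (allFin (suc n))))) (perms n))
      ≡⟨ sum-map-cong per-σ (perms n) ⟩
    sum (map (λ σ → length (filter (λ c → holds (insert σ c)) (allFin (suc n)))) (perms n)) ∎
    where
    open ≡-Reasoning
    per-σ : ∀ σ → length (filter holdsᵛ (map (H (table σ)) (allFin (suc n)))) ≡ length (filter (λ c → holds (insert σ c)) (allFin (suc n)))
    per-σ σ = trans (cong length (filter-map holdsᵛ (λ c → holds (insert σ c)) (H (table σ))
                                   (λ c → trans (does-holds-table (insert (Vec.lookup (table σ)) c))
                                                (cong (λ b → does (b Bool.≟ true)) (P-cong (insert-cong (Vec.lookup∘tabulate σ) c))))
                                   (allFin (suc n))))
                    (length-map (H (table σ)) (filter (λ c → holds (insert σ c)) (allFin (suc n))))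

statsMatch : ℕ → ℕ → ℕ → ℤ → ℤ → ℤ → Bool
statsMatch T S R t s r = ⌊ + T ℤ.≟ t ⌋ ∧ ⌊ + S ℤ.≟ s ⌋ ∧ ⌊ + R ℤ.≟ r ⌋

hasStats : ∀ {k} → ℤ → ℤ → ℤ → (Fin k → Fin k) → Bool
hasStats t s r π = statsMatch (cpk π) (cyc π) (fix π) t s r

hasStats-cong : ∀ {t s r k} {π π' : Fin k → Fin k} → (∀ x → π x ≡ π' x) → hasStats t s r π ≡ hasStats t s r π'
hasStats-cong {t} {s} {r} π≗π' =
  cong₂ (λ Cs f → statsMatch (sum (map peaksOf Cs)) (length Cs) f t s r) (cycles-cong π≗π') (fix-cong π≗π')

statsMatch⇒ : ∀ {T S R t s r} → statsMatch T S R t s r ≡ true → + T ≡ t × + S ≡ s × + R ≡ r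
statsMatch⇒ {T} {S} {R} {t} {s} {r} eq
  with (+ T) ℤ.≟ t | (+ S) ℤ.≟ s | (+ R) ℤ.≟ r | eq
... | yes T≡t | yes S≡s | yes R≡r | _ = T≡t , S≡s , R≡r

⌊+suc≟⌋ : ∀ X y → ⌊ + suc X ℤ.≟ y ⌋ ≡ ⌊ + X ℤ.≟ y ℤ.- + 1 ⌋
⌊+suc≟⌋ X y = trans (isYes≗does (+ suc X ℤ.≟ y)) (trans (does-⇔ (mk⇔ to from) (+ suc X ℤ.≟ y) (+ X ℤ.≟ y ℤ.- + 1)) (sym (isYes≗does (+ X ℤ.≟ y ℤ.- + 1))))
  where
  shift : ∀ x → x ℤ.+ + 1 ℤ.- + 1 ≡ x
  shift = ℤ.solve-∀
  unshift : ∀ x → x ℤ.- + 1 ℤ.+ + 1 ≡ x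
  unshift = ℤ.solve-∀
  to : + suc X ≡ y → + X ≡ y ℤ.- + 1
  to eq = trans (sym (shift (+ X))) (cong (ℤ._- + 1) (trans (sym (ℤ.pos-+ X 1)) (trans (cong +_ (+-comm X 1)) eq)))
  from : + X ≡ y ℤ.- + 1 → + suc X ≡ y
  from eq = trans (cong +_ (+-comm 1 X)) (trans (ℤ.pos-+ X 1) (trans (cong (ℤ._+ + 1) eq) (unshift y)))

statsMatch-shift : ∀ {T S R t s r} f g → (f ≡ 1 × g ≡ 0) ⊎ (f ≡ 0 × g ≡ 0) ⊎ (f ≡ 0 × g ≡ 1) →
  bit (statsMatch (g + T) S R t s r) ≡
  f * bit (statsMatch T S (f + R) t s (r ℤ.+ + 1)) + (1 ∸ (f + g)) * bit (statsMatch T S (f + R) t s r)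
    + g * bit (statsMatch T S (f + R) (t ℤ.- + 1) s r)
statsMatch-shift {T} {S} {R} {t} {s} {r} .1 .0 (inj₁ (refl , refl)) =
  trans (cong (λ b → bit (⌊ + T ℤ.≟ t ⌋ ∧ ⌊ + S ℤ.≟ s ⌋ ∧ b)) (sym shifted))
        (sym (drop₀₂ (bit (statsMatch T S (suc R) t s (r ℤ.+ + 1))) (bit (statsMatch T S (suc R) t s r))
                     (bit (statsMatch T S (suc R) (t ℤ.- + 1) s r))))
  where
  shifted : ⌊ + suc R ℤ.≟ r ℤ.+ + 1 ⌋ ≡ ⌊ + R ℤ.≟ r ⌋
  shifted = trans (⌊+suc≟⌋ R (r ℤ.+ + 1)) (cong (λ y → ⌊ + R ℤ.≟ y ⌋) (shift r))
    where
    shift : ∀ r → r ℤ.+ + 1 ℤ.- + 1 ≡ r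
    shift = ℤ.solve-∀
  drop₀₂ : ∀ x y w → 1 * x + 0 * y + 0 * w ≡ x
  drop₀₂ = solve-∀
statsMatch-shift {T} {S} {R} {t} {s} {r} .0 .0 (inj₂ (inj₁ (refl , refl))) =
  sym (drop₁₂ (bit (statsMatch T S R t s (r ℤ.+ + 1))) (bit (statsMatch T S R t s r)) (bit (statsMatch T S R (t ℤ.- + 1) s r)))
  where
  drop₁₂ : ∀ x y w → 0 * x + 1 * y + 0 * w ≡ y
  drop₁₂ = solve-∀
statsMatch-shift {T} {S} {R} {t} {s} {r} .0 .1 (inj₂ (inj₂ (refl , refl))) =
  trans (cong (λ b → bit (b ∧ ⌊ + S ℤ.≟ s ⌋ ∧ ⌊ + R ℤ.≟ r ⌋)) (⌊+suc≟⌋ T t))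
        (sym (drop₀₁ (bit (statsMatch T S R t s (r ℤ.+ + 1))) (bit (statsMatch T S R t s r)) (bit (statsMatch T S R (t ℤ.- + 1) s r))))
  where
  drop₀₁ : ∀ x y w → 0 * x + 0 * y + 1 * w ≡ w
  drop₀₁ = solve-∀

+-weight : ∀ b X (c : ℤ) → (b ≡ true → + X ≡ c) → + (bit b * X) ≡ c ℤ.* + bit b
+-weight false X c _ = sym (ℤ.*-zeroʳ c)
+-weight true  X c h = trans (cong +_ (+-identityʳ X)) (trans (h refl) (sym (ℤ.*-identityʳ c)))

does-≟-true : ∀ b → does (b Bool.≟ true) ≡ b
does-≟-true true  = refl
does-≟-true false = refl

module Insertions {n : ℕ} {σ : Fin n → Fin n} (O : Orbital σ) (t s r : ℤ) where

  open Statistics O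

  private
    Tσ Sσ Rσ : ℕ
    Tσ = cpk σ
    Sσ = cyc σ
    Rσ = fix σ
    ι : Fin n → Fin (suc n)
    ι = inject₁

  E₀ E₁ E₂ E₃ : ℕ
  E₀ = bit (statsMatch Tσ Sσ Rσ t s r)
  E₁ = bit (statsMatch Tσ Sσ Rσ t s (r ℤ.+ + 1))
  E₂ = bit (statsMatch Tσ Sσ Rσ (t ℤ.- + 1) s r)
  E₃ = bit (statsMatch Tσ Sσ Rσ t (s ℤ.- + 1) (r ℤ.- + 1))

  fixed : Fin n → ℕ
  fixed a = bit (does (σ a ≟ a))

  -- insertions after a that change neither the number of peaks nor of fixed points
  neutral : Fin n → ℕ
  neutral a = 1 ∸ (fixed a + newPeaks a)

  kinds : ∀ a → (fixed a ≡ 1 × newPeaks a ≡ 0) ⊎ (fixed a ≡ 0 × newPeaks a ≡ 0) ⊎ (fixed a ≡ 0 × newPeaks a ≡ 1)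
  kinds a = by-cases (σ a ≟ a)
    where
    by-cases : Dec (σ a ≡ a) → (fixed a ≡ 1 × newPeaks a ≡ 0) ⊎ (fixed a ≡ 0 × newPeaks a ≡ 0) ⊎ (fixed a ≡ 0 × newPeaks a ≡ 1)
    by-cases (yes σa≡a) = inj₁ (cong bit (dec-true (σ a ≟ a) σa≡a) , newPeaks-fixed a σa≡a)
    by-cases (no σa≢a) with newPeaks a | newPeaks≤1 a
    ... | 0 | _           = inj₂ (inj₁ (cong bit (dec-false (σ a ≟ a) σa≢a) , refl))
    ... | 1 | _           = inj₂ (inj₂ (cong bit (dec-false (σ a ≟ a) σa≢a) , refl))
    ... | suc (suc _) | s≤s ()

  neutral+fixed+newPeaks : ∀ a → neutral a + fixed a + newPeaks a ≡ 1
  neutral+fixed+newPeaks a with kinds a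
  ... | inj₁ (f≡1 , g≡0)        rewrite f≡1 | g≡0 = refl
  ... | inj₂ (inj₁ (f≡0 , g≡0)) rewrite f≡0 | g≡0 = refl
  ... | inj₂ (inj₂ (f≡0 , g≡1)) rewrite f≡0 | g≡1 = refl

  match-insert-inject₁ : ∀ a → bit (hasStats t s r (insert σ (ι a))) ≡ fixed a * E₁ + neutral a * E₀ + newPeaks a * E₂
  match-insert-inject₁ a = begin
    bit (statsMatch (cpk π) (cyc π) (fix π) t s r)
      ≡⟨ cong₂ (λ T' S' → bit (statsMatch T' S' (fix π) t s r))
               (trans (cpk-insert-inject₁ a) (+-comm Tσ (newPeaks a))) (cyc-insert-inject₁ O a) ⟩
    bit (statsMatch (newPeaks a + Tσ) Sσ (fix π) t s r)
      ≡⟨ statsMatch-shift {Tσ} {Sσ} {fix π} {t} {s} {r} (fixed a) (newPeaks a) (kinds a) ⟩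
    fixed a * bit (statsMatch Tσ Sσ (fixed a + fix π) t s (r ℤ.+ + 1)) + neutral a * bit (statsMatch Tσ Sσ (fixed a + fix π) t s r)
      + newPeaks a * bit (statsMatch Tσ Sσ (fixed a + fix π) (t ℤ.- + 1) s r)
      ≡⟨ cong (λ R' → fixed a * bit (statsMatch Tσ Sσ R' t s (r ℤ.+ + 1)) + neutral a * bit (statsMatch Tσ Sσ R' t s r)
                        + newPeaks a * bit (statsMatch Tσ Sσ R' (t ℤ.- + 1) s r))
              (trans (+-comm (fixed a) (fix π)) (fix-insert-inject₁ σ a)) ⟩
    fixed a * E₁ + neutral a * E₀ + newPeaks a * E₂ ∎
    where
    open ≡-Reasoning
    π : Fin (suc n) → Fin (suc n)
    π = insert σ (ι a)

  match-insert-fromℕ : bit (hasStats t s r (insert σ (fromℕ n))) ≡ E₃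
  match-insert-fromℕ = cong bit (begin
    statsMatch (cpk π) (cyc π) (fix π) t s r
      ≡⟨ cong₂ (λ T' SR → statsMatch T' (proj₁ SR) (proj₂ SR) t s r) (cpk-insert-fromℕ) (cong₂ _,_ (cyc-insert-fromℕ O) (fix-insert-fromℕ σ)) ⟩
    statsMatch Tσ (suc Sσ) (suc Rσ) t s r
      ≡⟨ cong₂ (λ b c → ⌊ + Tσ ℤ.≟ t ⌋ ∧ b ∧ c) (⌊+suc≟⌋ Sσ s) (⌊+suc≟⌋ Rσ r) ⟩
    statsMatch Tσ Sσ Rσ t (s ℤ.- + 1) (r ℤ.- + 1) ∎)
    where
    open ≡-Reasoning
    π : Fin (suc n) → Fin (suc n)
    π = insert σ (fromℕ n)

  count : length (filter (λ c → hasStats t s r (insert σ c) Bool.≟ true) (allFin (suc n))) ≡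
          E₁ * Rσ + E₀ * ∑ neutral + E₂ * ∑ newPeaks + E₃
  count = begin
    length (filter (λ c → hasStats t s r (insert σ c) Bool.≟ true) (allFin (suc n)))
      ≡⟨ length-filter≡sum (λ c → hasStats t s r (insert σ c) Bool.≟ true) (allFin (suc n)) ⟩
    sum (map (λ c → bit (does (hasStats t s r (insert σ c) Bool.≟ true))) (allFin (suc n)))
      ≡⟨ sum-map-allFin (suc n) _ ⟩
    ∑ (λ c → bit (does (hasStats t s r (insert σ c) Bool.≟ true)))
      ≡⟨ sum-cong-≗ (λ c → cong bit (does-≟-true (hasStats t s r (insert σ c)))) ⟩
    ∑ (λ c → bit (hasStats t s r (insert σ c)))
      ≡⟨ sum-init-last (λ c → bit (hasStats t s r (insert σ c))) ⟩
    ∑ (λ a → bit (hasStats t s r (insert σ (ι a)))) + bit (hasStats t s r (insert σ (fromℕ n)))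
      ≡⟨ cong₂ _+_ (trans (sum-cong-≗ match-insert-inject₁) (∑-linear₃ fixed neutral newPeaks E₁ E₀ E₂)) match-insert-fromℕ ⟩
    E₁ * ∑ fixed + E₀ * ∑ neutral + E₂ * ∑ newPeaks + E₃
      ≡⟨ cong (λ k → E₁ * k + E₀ * ∑ neutral + E₂ * ∑ newPeaks + E₃) (sym (fix≡∑ σ)) ⟩
    E₁ * Rσ + E₀ * ∑ neutral + E₂ * ∑ newPeaks + E₃ ∎
    where open ≡-Reasoning

  ∑-kinds : ∑ neutral + Rσ + ∑ newPeaks ≡ n
  ∑-kinds = begin
    ∑ neutral + Rσ + ∑ newPeaks                   ≡⟨ cong (λ k → ∑ neutral + k + ∑ newPeaks) (fix≡∑ σ) ⟩
    ∑ neutral + ∑ fixed + ∑ newPeaks             ≡⟨ cong (_+ ∑ newPeaks) (sym (∑-distrib-+ neutral fixed)) ⟩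
    ∑ (λ a → neutral a + fixed a) + ∑ newPeaks   ≡⟨ sym (∑-distrib-+ (λ a → neutral a + fixed a) newPeaks) ⟩
    ∑ (λ a → neutral a + fixed a + newPeaks a)   ≡⟨ sum-cong-≗ neutral+fixed+newPeaks ⟩
    ∑ {n} (λ _ → 1)                              ≡⟨ ∑-one n ⟩
    n                                            ∎
    where open ≡-Reasoning

  private
    +-sum3 : ∀ a b c d → a + b + c ≡ d → + a ℤ.+ + b ℤ.+ + c ≡ + d
    +-sum3 a b c d eq = trans (cong (ℤ._+ + c) (sym (ℤ.pos-+ a b))) (trans (sym (ℤ.pos-+ (a + b) c)) (cong +_ eq))

    rising-ℤ : + ∑ newPeaks ℤ.+ + Sσ ℤ.+ + 2 ℤ.* + Tσ ≡ + n
    rising-ℤ = trans (cong (λ k → + ∑ newPeaks ℤ.+ + Sσ ℤ.+ k) (sym (ℤ.pos-* 2 Tσ))) (+-sum3 (∑ newPeaks) Sσ (2 * Tσ) n ∑-newPeaks)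

  neutral-coefficient : statsMatch Tσ Sσ Rσ t s r ≡ true → + ∑ neutral ≡ + 2 ℤ.* t ℤ.+ s ℤ.- r
  neutral-coefficient match with statsMatch⇒ {Tσ} {Sσ} {Rσ} {t} {s} {r} match
  ... | T≡t , S≡s , R≡r = begin
    + Z                                                              ≡⟨ split (+ Z) (+ Rσ) (+ G) (+ Sσ) (+ Tσ) ⟩
    (+ Z ℤ.+ + Rσ ℤ.+ + G) ℤ.- (+ G ℤ.+ + Sσ ℤ.+ + 2 ℤ.* + Tσ) ℤ.+ w   ≡⟨ cong₂ (λ x y → x ℤ.- y ℤ.+ w) (+-sum3 Z Rσ G n ∑-kinds) rising-ℤ ⟩
    + n ℤ.- + n ℤ.+ w                                                ≡⟨ cancel (+ n) w ⟩
    + 2 ℤ.* + Tσ ℤ.+ + Sσ ℤ.- + Rσ                                   ≡⟨ cong (λ x → + 2 ℤ.* x ℤ.+ + Sσ ℤ.- + Rσ) T≡t ⟩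
    + 2 ℤ.* t ℤ.+ + Sσ ℤ.- + Rσ                                      ≡⟨ cong₂ (λ y z → + 2 ℤ.* t ℤ.+ y ℤ.- z) S≡s R≡r ⟩
    + 2 ℤ.* t ℤ.+ s ℤ.- r                                            ∎
    where
    open ≡-Reasoning
    Z G : ℕ
    Z = ∑ neutral
    G = ∑ newPeaks
    w : ℤ
    w = + 2 ℤ.* + Tσ ℤ.+ + Sσ ℤ.- + Rσ
    split : ∀ z ρ g σ τ → z ≡ (z ℤ.+ ρ ℤ.+ g) ℤ.- (g ℤ.+ σ ℤ.+ + 2 ℤ.* τ) ℤ.+ (+ 2 ℤ.* τ ℤ.+ σ ℤ.- ρ)
    split = ℤ.solve-∀
    cancel : ∀ m w → m ℤ.- m ℤ.+ w ≡ w
    cancel = ℤ.solve-∀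

  rising-coefficient : statsMatch Tσ Sσ Rσ (t ℤ.- + 1) s r ≡ true → + ∑ newPeaks ≡ + n ℤ.+ + 2 ℤ.- + 2 ℤ.* t ℤ.- s
  rising-coefficient match with statsMatch⇒ {Tσ} {Sσ} {Rσ} {t ℤ.- + 1} {s} {r} match
  ... | T≡t-1 , S≡s , _ = begin
    + G                                                          ≡⟨ split (+ G) (+ Sσ) (+ Tσ) ⟩
    (+ G ℤ.+ + Sσ ℤ.+ + 2 ℤ.* + Tσ) ℤ.- + Sσ ℤ.- + 2 ℤ.* + Tσ      ≡⟨ cong₂ (λ x y → x ℤ.- + Sσ ℤ.- + 2 ℤ.* y) rising-ℤ T≡t-1 ⟩
    + n ℤ.- + Sσ ℤ.- + 2 ℤ.* (t ℤ.- + 1)                          ≡⟨ unshift (+ n) (+ Sσ) t ⟩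
    + n ℤ.+ + 2 ℤ.- + 2 ℤ.* t ℤ.- + Sσ                            ≡⟨ cong (λ y → + n ℤ.+ + 2 ℤ.- + 2 ℤ.* t ℤ.- y) S≡s ⟩
    + n ℤ.+ + 2 ℤ.- + 2 ℤ.* t ℤ.- s                               ∎
    where
    open ≡-Reasoning
    G : ℕ
    G = ∑ newPeaks
    split : ∀ g σ τ → g ≡ (g ℤ.+ σ ℤ.+ + 2 ℤ.* τ) ℤ.- σ ℤ.- + 2 ℤ.* τ
    split = ℤ.solve-∀
    unshift : ∀ m σ t → m ℤ.- σ ℤ.- + 2 ℤ.* (t ℤ.- + 1) ≡ m ℤ.+ + 2 ℤ.- + 2 ℤ.* t ℤ.- σ
    unshift = ℤ.solve-∀

  count-ℤ : + length (filter (λ c → hasStats t s r (insert σ c) Bool.≟ true) (allFin (suc n))) ≡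
            (+ 2 ℤ.* t ℤ.+ s ℤ.- r) ℤ.* + E₀ ℤ.+ + E₃ ℤ.+ (r ℤ.+ + 1) ℤ.* + E₁ ℤ.+ (+ n ℤ.+ + 2 ℤ.- + 2 ℤ.* t ℤ.- s) ℤ.* + E₂
  count-ℤ = begin
    + length (filter (λ c → hasStats t s r (insert σ c) Bool.≟ true) (allFin (suc n)))
      ≡⟨ cong +_ count ⟩
    + (E₁ * Rσ + E₀ * ∑ neutral + E₂ * ∑ newPeaks + E₃)
      ≡⟨ trans (ℤ.pos-+ _ E₃) (cong (ℤ._+ + E₃) (trans (ℤ.pos-+ _ (E₂ * ∑ newPeaks)) (cong (ℤ._+ + (E₂ * ∑ newPeaks)) (ℤ.pos-+ (E₁ * Rσ) _)))) ⟩
    + (E₁ * Rσ) ℤ.+ + (E₀ * ∑ neutral) ℤ.+ + (E₂ * ∑ newPeaks) ℤ.+ + E₃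
      ≡⟨ cong (ℤ._+ + E₃) (cong₂ ℤ._+_ (cong₂ ℤ._+_
           (+-weight _ Rσ (r ℤ.+ + 1) (λ match → proj₂ (proj₂ (statsMatch⇒ {Tσ} {Sσ} {Rσ} {t} {s} {r ℤ.+ + 1} match))))
           (+-weight _ (∑ neutral) _ neutral-coefficient))
           (+-weight _ (∑ newPeaks) _ rising-coefficient)) ⟩
    (r ℤ.+ + 1) ℤ.* + E₁ ℤ.+ (+ 2 ℤ.* t ℤ.+ s ℤ.- r) ℤ.* + E₀ ℤ.+ (+ n ℤ.+ + 2 ℤ.- + 2 ℤ.* t ℤ.- s) ℤ.* + E₂ ℤ.+ + E₃
      ≡⟨ reorder ((r ℤ.+ + 1) ℤ.* + E₁) ((+ 2 ℤ.* t ℤ.+ s ℤ.- r) ℤ.* + E₀) ((+ n ℤ.+ + 2 ℤ.- + 2 ℤ.* t ℤ.- s) ℤ.* + E₂) (+ E₃) ⟩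
    (+ 2 ℤ.* t ℤ.+ s ℤ.- r) ℤ.* + E₀ ℤ.+ + E₃ ℤ.+ (r ℤ.+ + 1) ℤ.* + E₁ ℤ.+ (+ n ℤ.+ + 2 ℤ.- + 2 ℤ.* t ℤ.- s) ℤ.* + E₂ ∎
    where
    open ≡-Reasoning
    reorder : ∀ a b c d → a ℤ.+ b ℤ.+ c ℤ.+ d ≡ b ℤ.+ d ℤ.+ a ℤ.+ c
    reorder = ℤ.solve-∀

+-sum-linear : ∀ {A : Set} (xs : List A) (N E₀ E₃ E₁ E₂ : A → ℕ) (a b c : ℤ) →
  (∀ {x} → x ∈ xs → + N x ≡ a ℤ.* + E₀ x ℤ.+ + E₃ x ℤ.+ b ℤ.* + E₁ x ℤ.+ c ℤ.* + E₂ x) →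
  + sum (map N xs) ≡ a ℤ.* + sum (map E₀ xs) ℤ.+ + sum (map E₃ xs) ℤ.+ b ℤ.* + sum (map E₁ xs) ℤ.+ c ℤ.* + sum (map E₂ xs)
+-sum-linear []       N E₀ E₃ E₁ E₂ a b c _  = sym (zeros a b c)
  where
  zeros : ∀ a b c → a ℤ.* + 0 ℤ.+ + 0 ℤ.+ b ℤ.* + 0 ℤ.+ c ℤ.* + 0 ≡ + 0
  zeros = ℤ.solve-∀
+-sum-linear {A} (x ∷ xs) N E₀ E₃ E₁ E₂ a b c eq = begin
  + (N x + sum (map N xs))
    ≡⟨ ℤ.pos-+ (N x) _ ⟩
  + N x ℤ.+ + sum (map N xs)
    ≡⟨ cong₂ ℤ._+_ (eq (here refl)) (+-sum-linear xs N E₀ E₃ E₁ E₂ a b c (eq ∘ there)) ⟩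
  (a ℤ.* + E₀ x ℤ.+ + E₃ x ℤ.+ b ℤ.* + E₁ x ℤ.+ c ℤ.* + E₂ x) ℤ.+
  (a ℤ.* + Σ E₀ ℤ.+ + Σ E₃ ℤ.+ b ℤ.* + Σ E₁ ℤ.+ c ℤ.* + Σ E₂)
    ≡⟨ collect a b c (+ E₀ x) (+ E₃ x) (+ E₁ x) (+ E₂ x) (+ Σ E₀) (+ Σ E₃) (+ Σ E₁) (+ Σ E₂) ⟩
  a ℤ.* (+ E₀ x ℤ.+ + Σ E₀) ℤ.+ (+ E₃ x ℤ.+ + Σ E₃) ℤ.+ b ℤ.* (+ E₁ x ℤ.+ + Σ E₁) ℤ.+ c ℤ.* (+ E₂ x ℤ.+ + Σ E₂)
    ≡⟨ sym (cong₂ ℤ._+_ (cong₂ ℤ._+_ (cong₂ ℤ._+_ (cong (a ℤ.*_) (ℤ.pos-+ (E₀ x) _)) (ℤ.pos-+ (E₃ x) _))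
                                      (cong (b ℤ.*_) (ℤ.pos-+ (E₁ x) _))) (cong (c ℤ.*_) (ℤ.pos-+ (E₂ x) _))) ⟩
  a ℤ.* + sum (map E₀ (x ∷ xs)) ℤ.+ + sum (map E₃ (x ∷ xs)) ℤ.+ b ℤ.* + sum (map E₁ (x ∷ xs)) ℤ.+ c ℤ.* + sum (map E₂ (x ∷ xs)) ∎
  where
  open ≡-Reasoning
  Σ : (A → ℕ) → ℕ
  Σ f = sum (map f xs)
  collect : ∀ a b c e₀ e₃ e₁ e₂ f₀ f₃ f₁ f₂ →
            (a ℤ.* e₀ ℤ.+ e₃ ℤ.+ b ℤ.* e₁ ℤ.+ c ℤ.* e₂) ℤ.+ (a ℤ.* f₀ ℤ.+ f₃ ℤ.+ b ℤ.* f₁ ℤ.+ c ℤ.* f₂) ≡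
            a ℤ.* (e₀ ℤ.+ f₀) ℤ.+ (e₃ ℤ.+ f₃) ℤ.+ b ℤ.* (e₁ ℤ.+ f₁) ℤ.+ c ℤ.* (e₂ ℤ.+ f₂)
  collect = ℤ.solve-∀

p≡sum : ∀ n t s r → p n t s r ≡ sum (map (bit ∘ hasStats t s r) (perms n))
p≡sum n t s r = trans (length-filter≡sum (λ π → hasStats t s r π Bool.≟ true) (perms n))
                      (sum-map-cong (λ π → cong bit (does-≟-true (hasStats t s r π))) (perms n))

mainTheorem1 : (n : ℕ) → 1 ≤ n → (t s r : ℤ) →
    + p (suc n) t s r ≡
    ((+ 2) ℤ.* t ℤ.+ s ℤ.- r) ℤ.* (+ p n t s r)
    ℤ.+ (+ p n t (s ℤ.- + 1) (r ℤ.- + 1))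
    ℤ.+ (r ℤ.+ + 1) ℤ.* (+ p n t s (r ℤ.+ + 1))
    ℤ.+ (+ n ℤ.+ + 2 ℤ.- (+ 2) ℤ.* t ℤ.- s) ℤ.* (+ p n (t ℤ.- + 1) s r)
mainTheorem1 n _ t s r
  rewrite p≡sum n t s r | p≡sum n t (s ℤ.- + 1) (r ℤ.- + 1) | p≡sum n t s (r ℤ.+ + 1) | p≡sum n (t ℤ.- + 1) s r =
  trans (cong +_ (count-by-insertion (hasStats t s r) (hasStats-cong {t} {s} {r}) n))
        (+-sum-linear (perms n) insertions (matches t s r) (matches t (s ℤ.- + 1) (r ℤ.- + 1))
                      (matches t s (r ℤ.+ + 1)) (matches (t ℤ.- + 1) s r)
                      (+ 2 ℤ.* t ℤ.+ s ℤ.- r) (r ℤ.+ + 1) (+ n ℤ.+ + 2 ℤ.- + 2 ℤ.* t ℤ.- s) per-σ)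
  where
  matches : ℤ → ℤ → ℤ → (Fin n → Fin n) → ℕ
  matches t s r = bit ∘ hasStats t s r
  insertions : (Fin n → Fin n) → ℕ
  insertions σ = length (filter (λ c → hasStats t s r (insert σ c) Bool.≟ true) (allFin (suc n)))
  per-σ : ∀ {σ} → σ ∈ perms n →
          + insertions σ ≡ (+ 2 ℤ.* t ℤ.+ s ℤ.- r) ℤ.* + matches t s r σ ℤ.+ + matches t (s ℤ.- + 1) (r ℤ.- + 1) σ
                           ℤ.+ (r ℤ.+ + 1) ℤ.* + matches t s (r ℤ.+ + 1) σ ℤ.+ (+ n ℤ.+ + 2 ℤ.- + 2 ℤ.* t ℤ.- s) ℤ.* + matches (t ℤ.- + 1) s r σ
  per-σ σ∈ = let (inj , surj) = perms-sound σ∈ in Insertions.count-ℤ (Orbital-permutation n _ inj surj) t s r
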